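{- Let $\mathbb{H}$ be a gehm. If $\mathbb{H}$ has no hyperedges then $T(\mathbb{H};x,y)=1$. Otherwise, for each hyperedge $e$, \[T(\mathbb{H};x,y)=\sqrt{x-1}^{\,f(\mathbb{H}\setminus e)-f(\mathbb{H})+d(e)-1}\,T(\mathbb{H}\setminus e;x,y)+\sqrt{y-1}^{\,v(\mathbb{H}/ e)-v(\mathbb{H})+d(e)-1}\,T(\mathbb{H}/ e;x,y).\]
   Context: A gehm is a finite cubic graph whose edges are properly coloured with colours $b,g,r$, together with possibly some isolates ($g$-coloured edges meeting no vertex). Hyperedges are $b$--$r$-cycles, hyperfaces are $b$--$g$-cycles or isolates, hypervertices are $g$--$r$-cycles or isolates. $E(\mathbb{H})$, $e(\mathbb{H})$, $v(\mathbb{H})$, $f(\mathbb{H})$: set of hyperedges and numbers of hyperedges, hypervertices, hyperfaces; $k(\mathbb{H})$: number of components (isolates count); $d(e)$: half the number of gehm-edges in hyperedge $e$, $d(A)=\sum_{e\in A}d(e)$, $d(\mathbb{H})=d(E(\mathbb{H}))$; $\gamma(\mathbb{H})=2k(\mathbb{H})-v(\mathbb{H})-e(\mathbb{H})+d(\mathbb{H})-f(\mathbb{H})$. Suppressing a degree-two vertex: if its only edge is a loop, replace it and the loop by an isolate; otherwise contract one incident edge. $\mathbb{H}\setminus e$: delete the $b$-edges of $e$, contract its $r$-edges, suppress degree-two vertices. $\mathbb{H}/ e$: delete the $r$-edges of $e$, contract its $b$-edges, suppress degree-two vertices. For $A\subseteq E(\mathbb{H})$, $\mathbb{H}_{|A}$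 is obtained by deleting all hyperedges not in $A$; $v(A),k(A),f(A),\gamma(A)$ are the quantities of $\mathbb{H}_{|A}$. $\rho(\mathbb{H})=v(\mathbb{H})-k(\mathbb{H})+\tfrac12\gamma(\mathbb{H})$, $\rho(A)=v(A)-k(A)+\tfrac12\gamma(A)$. $T(\mathbb{H};x,y)=\sum_{A\subseteq E(\mathbb{H})}(x-1)^{\rho(\mathbb{H})-\rho(A)}(y-1)^{d(A)-|A|-\rho(A)}$. -}

module Defs where

open import Data.Bool using (Bool; true; false; if_then_else_)
open import Data.Nat as ℕ using (ℕ; zero; suc; _≤?_; ⌊_/2⌋; _+_)
open import Data.Nat.ListAction using (sum)
open import Data.Integer as ℤ using (ℤ; +_; -[1+_])
open import Data.List using (List; []; _∷_; _++_; map; filter; length; concatMap; deduplicate; foldr)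
open import Data.List.Relation.Unary.All using (All; all?)
open import Data.List.Relation.Unary.Unique.Propositional using (Unique)
open import Data.List.Membership.Propositional using (_∈_)
open import Data.List.Membership.DecPropositional ℕ._≟_ using (_∈?_; _∉?_)
open import Data.Product using (_×_; _,_; proj₁; proj₂)
open import Relation.Nullary using (¬_; does)
open import Relation.Nullary.Decidable using (_×-dec_)
open import Relation.Binary.PropositionalEquality using (_≡_; _≢_)
open import Algebra.Bundles using (CommutativeRing)

-- The vertices of the cubic graph are labelled by natural numbers (the
-- list `flags`, without repetition).  A proper 3-edge-colouring of a
-- cubic graph with colours b, g, r is the same thing as three
-- fixed-point-free involutions b, g, r on the vertex set: the c-edge at
-- x joins x to (c x).  Parallel edges (of different colours) are allowed.
-- `iso` is the number of isolates.

record RawGehm : Set where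
  constructor mkGehm
  field
    flags : List ℕ
    b g r : ℕ → ℕ
    iso   : ℕ
open RawGehm public

IsMatching : List ℕ → (ℕ → ℕ) → Set
IsMatching vs c = ∀ x → x ∈ vs → (c x ∈ vs) × (c x ≢ x) × (c (c x) ≡ x)

record IsGehm (H : RawGehm) : Set where
  field
    distinct : Unique (flags H)
    b-ok     : IsMatching (flags H) (b H)
    g-ok     : IsMatching (flags H) (g H)
    r-ok     : IsMatching (flags H) (r H)

step : List (ℕ → ℕ) → List ℕ → List ℕ
step cs R = deduplicate ℕ._≟_ (R ++ concatMap (λ z → map (λ c → c z) cs) R)

closeK : ℕ → List (ℕ → ℕ) → List ℕ → List ℕ
closeK zero    cs R = R
closeK (suc k) cs R = closeK k cs (step cs R)

-- the component (orbit) of x in the subgraph with edge colours cs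
-- (|flags| closure steps suffice)
orbit : RawGehm → List (ℕ → ℕ) → ℕ → List ℕ
orbit H cs x = closeK (length (flags H)) cs (x ∷ [])

isRep : RawGehm → List (ℕ → ℕ) → ℕ → Bool
isRep H cs x = does (all? (x ≤?_) (orbit H cs x))

countCycles : RawGehm → List (ℕ → ℕ) → ℕ
countCycles H cs = length (filter (λ x → all? (x ≤?_) (orbit H cs x)) (flags H))

Hyperedge : Set
Hyperedge = List ℕ

hyperedges : RawGehm → List Hyperedge
hyperedges H =
  map (orbit H (b H ∷ r H ∷ [])) (filter (λ x → all? (x ≤?_) (orbit H (b H ∷ r H ∷ []) x)) (flags H))

-- d(e): half the number of gehm-edges in e (a b–r-cycle on 2m vertices has 2m edges)
dEdge : Hyperedge → ℕ
dEdge e = ⌊ length e /2⌋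

dSet : List Hyperedge → ℕ
dSet A = sum (map dEdge A)

eH dH vH fH kH : RawGehm → ℕ
eH H = length (hyperedges H)
dH H = dSet (hyperedges H)
vH H = countCycles H (g H ∷ r H ∷ []) + iso H   -- g–r-cycles or isolates
fH H = countCycles H (b H ∷ g H ∷ []) + iso H   -- b–g-cycles or isolates
kH H = countCycles H (b H ∷ g H ∷ r H ∷ []) + iso H

γ : RawGehm → ℤ
γ H = (+ (2 ℕ.* kH H) ℤ.- + vH H ℤ.- + eH H ℤ.+ + dH H) ℤ.- + fH H

-- twice ρ : 2ρ(H) = 2v - 2k + γ   (ρ itself may be a half-integer)
ρ2 : RawGehm → ℤ
ρ2 H = (+ (2 ℕ.* vH H) ℤ.- + (2 ℕ.* kH H)) ℤ.+ γ H

-- Deleting the `del`-edges of e and contracting its `con`-edges leaves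
-- every vertex of e with degree two (only its g-edge remains), and
-- suppressing all those degree-two vertices splices the g-edges:
-- a vertex x outside e gets as new g-neighbour the first vertex outside e
-- on the walk  g x, g (con (g x)), ...  (alternating contracted con-edges
-- and g-edges).  A g–con-cycle lying entirely inside e collapses to a
-- vertex carrying a g-loop, which is replaced by an isolate.

spliceWalk : ℕ → Hyperedge → (ℕ → ℕ) → (ℕ → ℕ) → ℕ → ℕ
spliceWalk zero    e gg con y = y
spliceWalk (suc k) e gg con y =
  if does (y ∈? e) then spliceWalk k e gg con (gg (con y)) else y

insideCycles : RawGehm → (ℕ → ℕ) → Hyperedge → ℕ
insideCycles H con e =
  length (filter (λ x → all? (x ≤?_) (orbit H (g H ∷ con ∷ []) x)
                         ×-dec all? (_∈? e) (orbit H (g H ∷ con ∷ []) x)) e)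

splice : RawGehm → (ℕ → ℕ) → Hyperedge → RawGehm
splice H con e = mkGehm
  (filter (_∉? e) (flags H))
  (b H)
  (λ x → spliceWalk (length (flags H)) e (g H) con (g H x))
  (r H)
  (iso H + insideCycles H con e)


-- H \ e : delete the b-edges of e, contract its r-edges, suppress
_∖ₕ_ : RawGehm → Hyperedge → RawGehm
H ∖ₕ e = splice H (r H) e

-- H / e : delete the r-edges of e, contract its b-edges, suppress
_/ₕ_ : RawGehm → Hyperedge → RawGehm
H /ₕ e = splice H (b H) e

-- Subsets A ⊆ E(H), each paired with its complement E(H) ∖ A.

splits : {X : Set} → List X → List (List X × List X)
splits []       = ( [] , [] ) ∷ []
splits (x ∷ xs) =
  map (λ p → (x ∷ proj₁ p , proj₂ p)) (splits xs) ++
  map (λ p → (proj₁ p , x ∷ proj₂ p)) (splits xs)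

-- H restricted to A: delete all hyperedges not in A (given as the complement list)
restrict : RawGehm → List Hyperedge → RawGehm
restrict H notA = foldr (λ e G → G ∖ₕ e) H notA

-- The Tutte polynomial, evaluated in a commutative ring R at
-- √(x-1) = u and √(y-1) = w, where u, w are units (inverses u⁻, w⁻),
-- so that arbitrary integer powers of √(x-1), √(y-1) make sense.

module TuttePoly {c ℓ} (R : CommutativeRing c ℓ) where
  open CommutativeRing R

  pow : Carrier → ℕ → Carrier
  pow a zero    = 1#
  pow a (suc n) = a * pow a n

  powℤ : Carrier → Carrier → ℤ → Carrier
  powℤ a a⁻ (+ n)    = pow a n
  powℤ a a⁻ -[1+ n ] = pow a⁻ (suc n)

  sumR : List Carrier → Carrier
  sumR = foldr (CommutativeRing._+_ R) 0#

  -- T(H;x,y) = Σ_A (x-1)^{ρ(H)-ρ(A)} (y-1)^{d(A)-|A|-ρ(A)}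
  --          = Σ_A √(x-1)^{2ρ(H)-2ρ(A)} √(y-1)^{2d(A)-2|A|-2ρ(A)}
  T : (u u⁻ w w⁻ : Carrier) → RawGehm → Carrier
  T u u⁻ w w⁻ H = sumR (map term (splits (hyperedges H)))
    where
    term : List Hyperedge × List Hyperedge → Carrier
    term (A , notA) =
      powℤ u u⁻ (ρ2 H ℤ.- ρ2 (restrict H notA)) *
      powℤ w w⁻ (((+ (2 ℕ.* dSet A)) ℤ.- + (2 ℕ.* length A)) ℤ.- ρ2 (restrict H notA))

{-# OPTIONS --safe #-}
-- Deletion and contraction of e are both splices: the vertices of e are removed and each g-edge entering e
-- is continued through e along its contracted colour (r for H ∖ₕ e, b for H /ₕ e) until it leaves e again,
-- a cycle of g and that colour lying inside e becoming an isolate. A splice along e removes exactly e from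
-- the hyperedges, keeps the number of such cycles plus isolates (so v(H ∖ e) = v(H) and f(H / e) = f(H)),
-- and commutes with splices along other hyperedges. Hence, for A ⊆ E(H), restricting H to A ∌ e is
-- restricting H ∖ e to A, while restricting to A ∋ e and then contracting e is restricting H / e to
-- A ∖ {e}, and 2ρ drops under this contraction by as much as from H to H / e. Splitting the sum defining T
-- according to whether e ∈ A therefore turns each summand into the matching summand of T(H ∖ e) or
-- T(H / e) times the stated power of √(x−1) or √(y−1). Without hyperedges there are no vertices, so ρ = 0.
module Submission where

open import Defs
open import Data.Nat using (ℕ)
open import Data.Integer using (ℤ; +_) renaming (_+_ to _+ℤ_; _-_ to _-ℤ_)
open import Data.List using (List; [])
open import Data.List.Membership.Propositional using (_∈_)
open import Data.Product using (_×_)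
open import Relation.Binary.PropositionalEquality using (_≡_)
open import Algebra.Bundles using (CommutativeRing)
open import Level using (Level)

open import Data.Bool using (true; false; if_then_else_)
open import Data.Empty using (⊥; ⊥-elim)
import Data.Integer as ℤ
open Data.Integer using (-[1+_])
import Data.Integer.Properties as ℤₚ
open import Data.Integer.Solver using (module +-*-Solver)
open import Data.Unit using (⊤; tt)
import Data.Nat as ℕ
open Data.Nat using (zero; suc; _≤_; _<_; z≤n; s≤s; _≤?_; _≟_)
import Data.Nat.Properties as ℕₚ
open import Data.List.Extrema.Nat using (min; min≤⊤; min≤xs; argmin-sel)
open Data.List using (_∷_; _++_; map; filter; length; concat; concatMap; deduplicate; applyUpTo)
import Data.List.Properties as Listₚ
open import Data.List.Relation.Unary.All as All using (All; []; _∷_)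
open import Data.List.Relation.Binary.Pointwise using (Pointwise; []; _∷_)
open import Data.List.Relation.Binary.Sublist.Propositional using (_⊆_; []; _∷_; _∷ʳ_; ⊆-refl)
import Data.List.Relation.Binary.Sublist.Propositional.Properties as Sublistₚ
import Data.List.Relation.Unary.All.Properties as Allₚ
open import Data.List.Relation.Unary.Any as Any using (Any; here; there)
import Data.List.Relation.Unary.Any.Properties as Anyₚ
open import Data.List.Relation.Unary.Unique.Propositional using (Unique)
open import Data.List.Relation.Unary.AllPairs using ([]; _∷_)
import Data.List.Relation.Unary.Unique.Propositional.Properties as Uniqueₚ
open import Data.List.Relation.Unary.Unique.DecPropositional.Properties _≟_ using (deduplicate-!)
open Data.List.Membership.Propositional using (_∉_; find)
open import Data.List.Membership.DecPropositional _≟_ using (_∈?_; _∉?_)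
import Data.List.Membership.Propositional.Properties as ∈ₚ
open import Data.List.Membership.Propositional.Properties.WithK using (unique∧set⇒bag)
open import Data.List.Relation.Binary.BagAndSetEquality using (_∼[_]_; set; ∼bag⇒↭)
open import Data.List.Relation.Binary.Permutation.Propositional using (_↭_; ↭⇒↭ₛ)
import Data.List.Relation.Binary.Permutation.Setoid.Properties as ↭ₛₚ
import Data.List.Relation.Binary.Permutation.Propositional.Properties as ↭ₚ
open import Data.Nat.ListAction.Properties using (sum-↭)
open Data.Product using (_,_; proj₁; proj₂; ∃; uncurry)
open import Data.Sum using (_⊎_; inj₁; inj₂; [_,_]′)
open import Function.Base using (_∘_; case_of_)
open import Function.Bundles using (Equivalence; mk⇔)
open Equivalence using (to; from)
open import Relation.Nullary using (¬_; Dec; yes; no; does)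
open import Relation.Nullary.Decidable using (_×-dec_; ¬?; decidable-stable)
open import Relation.Unary using (Pred; Decidable)
open import Relation.Binary.Construct.Closure.ReflexiveTransitive as Star using (Star; ε; _◅_; _◅◅_)
open Relation.Binary.PropositionalEquality using (refl; sym; trans; cong; cong₂; subst; subst₂; _≢_)
import Relation.Binary.PropositionalEquality as ≡


∼set-sym : {xs ys : List ℕ} → xs ∼[ set ] ys → ys ∼[ set ] xs
∼set-sym xs∼ys = mk⇔ (from xs∼ys) (to xs∼ys)

∼set-trans : {xs ys zs : List ℕ} → xs ∼[ set ] ys → ys ∼[ set ] zs → xs ∼[ set ] zs
∼set-trans xs∼ys ys∼zs = mk⇔ (to ys∼zs ∘ to xs∼ys) (from xs∼ys ∘ from ys∼zs)

filter⁺-∼set : ∀ {p} {P : Pred ℕ p} (P? : Decidable P) {xs ys : List ℕ} →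
               xs ∼[ set ] ys → filter P? xs ∼[ set ] filter P? ys
filter⁺-∼set P? xs∼ys = mk⇔ (transport xs∼ys) (transport (∼set-sym xs∼ys))
  where
  transport : ∀ {us vs} → us ∼[ set ] vs → ∀ {x} → x ∈ filter P? us → x ∈ filter P? vs
  transport {us} us∼vs m =
    let (m′ , px) = ∈ₚ.∈-filter⁻ P? {xs = us} m in ∈ₚ.∈-filter⁺ P? (to us∼vs m′) px

length-∼set : {xs ys : List ℕ} → Unique xs → Unique ys → xs ∼[ set ] ys → length xs ≡ length ys
length-∼set ux uy xs∼ys = ↭ₚ.↭-length (∼bag⇒↭ (unique∧set⇒bag ux uy xs∼ys))

length-filter-∼set : ∀ {p} {P : Pred ℕ p} (P? : Decidable P) {xs ys : List ℕ} →
                     Unique xs → Unique ys → xs ∼[ set ] ys →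
                     length (filter P? xs) ≡ length (filter P? ys)
length-filter-∼set P? ux uy xs∼ys =
  length-∼set (Uniqueₚ.filter⁺ P? ux) (Uniqueₚ.filter⁺ P? uy) (filter⁺-∼set P? xs∼ys)

unique-⊆⇒length≤ : {xs ys : List ℕ} → Unique xs → Unique ys → (∀ {x} → x ∈ xs → x ∈ ys) →
                   length xs ≤ length ys
unique-⊆⇒length≤ {xs} {ys} ux uy xs⊆ys = begin
  length xs                      ≡⟨ length-∼set ux (Uniqueₚ.filter⁺ (_∈? xs) uy) xs∼ys′ ⟩
  length (filter (_∈? xs) ys)    ≤⟨ Listₚ.length-filter (_∈? xs) ys ⟩
  length ys                      ∎
  where
  open ℕₚ.≤-Reasoning
  xs∼ys′ : xs ∼[ set ] filter (_∈? xs) ys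
  xs∼ys′ = mk⇔ (λ m → ∈ₚ.∈-filter⁺ (_∈? xs) (xs⊆ys m) m)
               (λ m → proj₂ (∈ₚ.∈-filter⁻ (_∈? xs) {xs = ys} m))

Unique-⊆ : {X : Set} {xs ys : List X} → xs ⊆ ys → Unique ys → Unique xs
Unique-⊆ []         []         = []
Unique-⊆ (y ∷ʳ τ)   (_ ∷ u)    = Unique-⊆ τ u
Unique-⊆ (refl ∷ τ) (y∉ys ∷ u) =
  All.tabulate (λ m → All.lookup y∉ys (Sublistₚ.Any-resp-⊆ τ m)) ∷ Unique-⊆ τ u

module _ {A : Set} {p q} {P : Pred A p} {Q : Pred A q} (P? : Decidable P) (Q? : Decidable Q) where

  filter-cong-∈ : ∀ xs → (∀ x → x ∈ xs → P x → Q x) → (∀ x → x ∈ xs → Q x → P x) →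
                  filter P? xs ≡ filter Q? xs
  filter-cong-∈ []       P⇒Q Q⇒P = refl
  filter-cong-∈ (x ∷ xs) P⇒Q Q⇒P with P? x | Q? x
  ... | yes px | yes qx = cong (x ∷_) (filter-cong-∈ xs (λ y → P⇒Q y ∘ there) (λ y → Q⇒P y ∘ there))
  ... | yes px | no ¬qx = ⊥-elim (¬qx (P⇒Q x (here refl) px))
  ... | no ¬px | yes qx = ⊥-elim (¬px (Q⇒P x (here refl) qx))
  ... | no ¬px | no ¬qx = filter-cong-∈ xs (λ y → P⇒Q y ∘ there) (λ y → Q⇒P y ∘ there)

  filter-filter : ∀ xs → filter P? (filter Q? xs) ≡ filter (λ x → P? x ×-dec Q? x) xs
  filter-filter []       = refl
  filter-filter (x ∷ xs) with Q? x
  ... | yes qx with P? x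
  ...   | yes px = cong (x ∷_) (filter-filter xs)
  ...   | no ¬px = filter-filter xs
  filter-filter (x ∷ xs) | no ¬qx with P? x
  ...   | yes px = filter-filter xs
  ...   | no ¬px = filter-filter xs

  length-filter-split : ∀ xs → length (filter P? xs) ≡
    length (filter (λ x → P? x ×-dec Q? x) xs) ℕ.+ length (filter (λ x → P? x ×-dec ¬? (Q? x)) xs)
  length-filter-split []       = refl
  length-filter-split (x ∷ xs) with P? x | Q? x
  ... | yes px | yes qx = cong suc (length-filter-split xs)
  ... | yes px | no ¬qx = trans (cong suc (length-filter-split xs)) (sym (ℕₚ.+-suc _ _))
  ... | no ¬px | yes qx = length-filter-split xs
  ... | no ¬px | no ¬qx = length-filter-split xs

length-filter-cong-∈ : ∀ {p q} {P : Pred ℕ p} {Q : Pred ℕ q} (P? : Decidable P) (Q? : Decidable Q) xs →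
                       (∀ x → x ∈ xs → P x → Q x) → (∀ x → x ∈ xs → Q x → P x) →
                       length (filter P? xs) ≡ length (filter Q? xs)
length-filter-cong-∈ P? Q? xs P⇒Q Q⇒P = cong length (filter-cong-∈ P? Q? xs P⇒Q Q⇒P)

length-filter-⊆ : ∀ {p} {P : Pred ℕ p} (P? : Decidable P) (xs ys : List ℕ) → Unique xs → Unique ys →
                  (∀ {y} → y ∈ ys → y ∈ xs) → (∀ x → x ∈ xs → P x → x ∈ ys) →
                  length (filter P? xs) ≡ length (filter P? ys)
length-filter-⊆ P? xs ys ux uy ys⊆xs P⇒∈ys = begin
  length (filter P? xs)
    ≡⟨ length-filter-cong-∈ P? (λ x → P? x ×-dec (x ∈? ys)) xs (λ x m px → px , P⇒∈ys x m px)
                                                                (λ _ _ → proj₁) ⟩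
  length (filter (λ x → P? x ×-dec (x ∈? ys)) xs)
    ≡⟨ cong length (filter-filter P? (_∈? ys) xs) ⟨
  length (filter P? (filter (_∈? ys) xs))
    ≡⟨ length-filter-∼set P? (Uniqueₚ.filter⁺ (_∈? ys) ux) uy ∼ys ⟩
  length (filter P? ys)
    ∎
  where
  open ≡.≡-Reasoning
  ∼ys : filter (_∈? ys) xs ∼[ set ] ys
  ∼ys = mk⇔ (λ m → proj₂ (∈ₚ.∈-filter⁻ (_∈? ys) {xs = xs} m))
            (λ m → ∈ₚ.∈-filter⁺ (_∈? ys) (ys⊆xs m) m)

map-filter : ∀ {A B : Set} {p q} {P : Pred A p} {Q : Pred B q} (f : A → B) (P? : Decidable P) (Q? : Decidable Q) →
             ∀ xs → (∀ x → x ∈ xs → P x → Q (f x)) → (∀ x → x ∈ xs → Q (f x) → P x) →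
             map f (filter P? xs) ≡ filter Q? (map f xs)
map-filter f P? Q? []       P⇒Q Q⇒P = refl
map-filter f P? Q? (x ∷ xs) P⇒Q Q⇒P with P? x | Q? (f x)
... | yes px | yes qx = cong (f x ∷_) (map-filter f P? Q? xs (λ y → P⇒Q y ∘ there) (λ y → Q⇒P y ∘ there))
... | yes px | no ¬qx = ⊥-elim (¬qx (P⇒Q x (here refl) px))
... | no ¬px | yes qx = ⊥-elim (¬px (Q⇒P x (here refl) qx))
... | no ¬px | no ¬qx = map-filter f P? Q? xs (λ y → P⇒Q y ∘ there) (λ y → Q⇒P y ∘ there)

InjectiveOn : {B : Set} → (ℕ → B) → List ℕ → Set
InjectiveOn f xs = ∀ {a b} → a ∈ xs → b ∈ xs → f a ≡ f b → a ≡ b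

map⁺-unique : {B : Set} (f : ℕ → B) {xs : List ℕ} → Unique xs → InjectiveOn f xs → Unique (map f xs)
map⁺-unique f {[]}     []         inj = []
map⁺-unique f {x ∷ xs} (x∉xs ∷ u) inj =
  Allₚ.map⁺ (All.tabulate λ m fx≡fy → All.lookup x∉xs m (inj (here refl) (there m) fx≡fy))
  ∷ map⁺-unique f u (λ ma mb → inj (there ma) (there mb))

length-bijection : (xs ys : List ℕ) → Unique xs → Unique ys → (f h : ℕ → ℕ) →
                   (∀ {x} → x ∈ xs → f x ∈ ys) → (∀ {y} → y ∈ ys → h y ∈ xs) →
                   (∀ {x} → x ∈ xs → h (f x) ≡ x) → (∀ {y} → y ∈ ys → f (h y) ≡ y) →
                   length xs ≡ length ys
length-bijection xs ys ux uy f h f∈ h∈ hf fh =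
  trans (sym (Listₚ.length-map f xs)) (length-∼set (map⁺-unique f ux f-inj) uy (mk⇔ ⇒ys ⇐ys))
  where
  f-inj : InjectiveOn f xs
  f-inj ma mb fa≡fb = trans (sym (hf ma)) (trans (cong h fa≡fb) (hf mb))
  ⇒ys : ∀ {y} → y ∈ map f xs → y ∈ ys
  ⇒ys m = let (x , mx , y≡fx) = ∈ₚ.∈-map⁻ f m in subst (_∈ ys) (sym y≡fx) (f∈ mx)
  ⇐ys : ∀ {y} → y ∈ ys → y ∈ map f xs
  ⇐ys m = subst (_∈ map f xs) (fh m) (∈ₚ.∈-map⁺ f (h∈ m))

IsMin : ℕ → List ℕ → Set
IsMin x xs = All (x ≤_) xs

isMin? : ∀ x xs → Dec (IsMin x xs)
isMin? x xs = All.all? (x ≤?_) xs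

minimum : List ℕ → ℕ
minimum []       = 0
minimum (x ∷ xs) = min x xs

minimum-∈ : ∀ {x} xs → x ∈ xs → minimum xs ∈ xs
minimum-∈ (y ∷ ys) _ with argmin-sel (λ z → z) y ys
... | inj₁ min≡y  = here min≡y
... | inj₂ min∈ys = there min∈ys

minimum-≤ : ∀ {x} xs → x ∈ xs → minimum xs ≤ x
minimum-≤ (y ∷ ys) (here refl) = min≤⊤ y ys
minimum-≤ (y ∷ ys) (there m)   = All.lookup (min≤xs y ys) m

minimum-isMin : ∀ xs → IsMin (minimum xs) xs
minimum-isMin xs = All.tabulate (minimum-≤ xs)

isMin⇒minimum≡ : ∀ {x} xs → x ∈ xs → IsMin x xs → minimum xs ≡ x
isMin⇒minimum≡ xs m x-min = ℕₚ.≤-antisym (minimum-≤ xs m) (All.lookup x-min (minimum-∈ xs m))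

minimum-∼set : ∀ {x} xs ys → x ∈ xs → xs ∼[ set ] ys → minimum xs ≡ minimum ys
minimum-∼set xs ys m xs∼ys = ℕₚ.≤-antisym (minimum-≤ xs (from xs∼ys (minimum-∈ ys (to xs∼ys m))))
                                           (minimum-≤ ys (to xs∼ys (minimum-∈ xs m)))


-- Closures under a list of colour involutions

Step : List (ℕ → ℕ) → ℕ → ℕ → Set
Step cs y z = Any (λ c → z ≡ c y) cs

Reach : List (ℕ → ℕ) → ℕ → ℕ → Set
Reach cs = Star (Step cs)

infixl 5 _▷_

_▷_ : ∀ {cs x y z} → Reach cs x y → Step cs y z → Reach cs x z
r ▷ s = r ◅◅ Star.return s

Closed : List (ℕ → ℕ) → List ℕ → Set
Closed cs R = ∀ {y z} → y ∈ R → Step cs y z → z ∈ R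

InvolutionOn : List ℕ → (ℕ → ℕ) → Set
InvolutionOn V c = ∀ {x} → x ∈ V → c x ∈ V × c (c x) ≡ x

Reach-closed : ∀ {cs R x y} → Closed cs R → x ∈ R → Reach cs x y → y ∈ R
Reach-closed closed x∈R ε       = x∈R
Reach-closed closed x∈R (s ◅ r) = Reach-closed closed (closed x∈R s) r

involutions-closed : ∀ {V cs} → All (InvolutionOn V) cs → Closed cs V
involutions-closed (i ∷ _)  x∈V (here refl) = proj₁ (i x∈V)
involutions-closed (_ ∷ is) x∈V (there s)   = involutions-closed is x∈V s

Reach-sym : ∀ {cs V x y} → All (InvolutionOn V) cs → x ∈ V → Reach cs x y → Reach cs y x
Reach-sym inv x∈V ε       = ε
Reach-sym inv x∈V (s ◅ r) = Reach-sym inv (involutions-closed inv x∈V s) r ▷ Step-sym inv x∈V s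
  where
  Step-sym : ∀ {V cs y z} → All (InvolutionOn V) cs → y ∈ V → Step cs y z → Step cs z y
  Step-sym (i ∷ _)  y∈V (here refl) = here (sym (proj₂ (i y∈V)))
  Step-sym (_ ∷ is) y∈V (there s)   = there (Step-sym is y∈V s)

closed? : ∀ cs R → Closed cs R ⊎ (∃ λ y → ∃ λ z → y ∈ R × Step cs y z × z ∉ R)
closed? cs R with All.all? (λ y → All.all? (λ c → c y ∈? R) cs) R
... | yes all∈ = inj₁ λ y∈R s → lookup-step (All.lookup all∈ y∈R) s
  where
  lookup-step : ∀ {y z cs′} → All (λ c → c y ∈ R) cs′ → Step cs′ y z → z ∈ R
  lookup-step (c∈ ∷ _)  (here refl) = c∈
  lookup-step (_ ∷ cs∈) (there s)   = lookup-step cs∈ s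
... | no ¬all∈ =
  let (y , y∈R , ¬cs∈) = find (Allₚ.¬All⇒Any¬ (λ y → All.all? (λ c → c y ∈? R) cs) R ¬all∈)
      (c , c∈cs , cy∉R) = find (Allₚ.¬All⇒Any¬ (λ c → c y ∈? R) cs ¬cs∈)
  in inj₂ (y , c y , y∈R , Any.map (λ c≡ → cong (λ f → f y) c≡) c∈cs , cy∉R)

dedup : List ℕ → List ℕ
dedup = deduplicate _≟_

dedup-unique : ∀ xs → Unique xs → dedup xs ≡ xs
dedup-unique []       []         = refl
dedup-unique (x ∷ xs) (x∉xs ∷ u) = cong (x ∷_) (begin
  filter (λ y → ¬? (x ≟ y)) (dedup xs)   ≡⟨ cong (filter (λ y → ¬? (x ≟ y))) (dedup-unique xs u) ⟩
  filter (λ y → ¬? (x ≟ y)) xs           ≡⟨ Listₚ.filter-all (λ y → ¬? (x ≟ y)) x∉xs ⟩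
  xs                                     ∎)
  where open ≡.≡-Reasoning

dedup-++ : ∀ xs ys → dedup (xs ++ ys) ≡ dedup xs ++ filter (_∉? xs) (dedup ys)
dedup-++ []       ys = sym (Listₚ.filter-all (_∉? []) (All.tabulate (λ _ ())))
dedup-++ (x ∷ xs) ys = cong (x ∷_) (begin
  filter (x ≢?_) (dedup (xs ++ ys))
    ≡⟨ cong (filter (x ≢?_)) (dedup-++ xs ys) ⟩
  filter (x ≢?_) (dedup xs ++ filter (_∉? xs) (dedup ys))
    ≡⟨ Listₚ.filter-++ (x ≢?_) (dedup xs) _ ⟩
  filter (x ≢?_) (dedup xs) ++ filter (x ≢?_) (filter (_∉? xs) (dedup ys))
    ≡⟨ cong (filter (x ≢?_) (dedup xs) ++_) (filter-filter (x ≢?_) (_∉? xs) (dedup ys)) ⟩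
  filter (x ≢?_) (dedup xs) ++ filter (λ z → x ≢? z ×-dec z ∉? xs) (dedup ys)
    ≡⟨ cong (filter (x ≢?_) (dedup xs) ++_) (filter-cong-∈ _ (_∉? (x ∷ xs)) (dedup ys) ⇒ ⇐) ⟩
  filter (x ≢?_) (dedup xs) ++ filter (_∉? (x ∷ xs)) (dedup ys) ∎)
  where
  open ≡.≡-Reasoning
  _≢?_ : ∀ a b → Dec (a ≢ b)
  a ≢? b = ¬? (a ≟ b)
  ⇒ : ∀ z → z ∈ dedup ys → x ≢ z × z ∉ xs → z ∉ x ∷ xs
  ⇒ z _ (x≢z , z∉xs) (here z≡x) = x≢z (sym z≡x)
  ⇒ z _ (x≢z , z∉xs) (there m)  = z∉xs m
  ⇐ : ∀ z → z ∈ dedup ys → z ∉ x ∷ xs → x ≢ z × z ∉ xs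
  ⇐ z _ z∉ = (λ x≡z → z∉ (here (sym x≡z))) , (λ m → z∉ (there m))

∈-step⁻ : ∀ cs R {z} → z ∈ step cs R → z ∈ R ⊎ (∃ λ y → y ∈ R × Step cs y z)
∈-step⁻ cs R m with ∈ₚ.∈-++⁻ R (∈ₚ.∈-deduplicate⁻ _≟_ (R ++ _) m)
... | inj₁ z∈R = inj₁ z∈R
... | inj₂ z∈new with ∈ₚ.∈-concat⁻′ (map (λ z → map (λ c → c z) cs) R) z∈new
...   | (_ , z∈cs-images , cs-images∈) with ∈ₚ.∈-map⁻ (λ z → map (λ c → c z) cs) cs-images∈
...     | (y , y∈R , refl) = inj₂ (y , y∈R , Anyₚ.map⁻ z∈cs-images)

∈-step⁺ˡ : ∀ cs R {z} → z ∈ R → z ∈ step cs R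
∈-step⁺ˡ cs R m = ∈ₚ.∈-deduplicate⁺ _≟_ (∈ₚ.∈-++⁺ˡ m)

∈-step⁺ʳ : ∀ cs R {y z} → y ∈ R → Step cs y z → z ∈ step cs R
∈-step⁺ʳ cs R y∈R s = ∈ₚ.∈-deduplicate⁺ _≟_ (∈ₚ.∈-++⁺ʳ R
  (∈ₚ.∈-concat⁺′ (Anyₚ.map⁺ s) (∈ₚ.∈-map⁺ (λ z → map (λ c → c z) cs) y∈R)))

step-⊆ : ∀ cs {V R} → Closed cs V → (∀ {z} → z ∈ R → z ∈ V) → ∀ {z} → z ∈ step cs R → z ∈ V
step-⊆ cs {R = R} closed R⊆V m with ∈-step⁻ cs R m
... | inj₁ z∈R           = R⊆V z∈R
... | inj₂ (y , y∈R , s) = closed (R⊆V y∈R) s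

step-unique : ∀ cs R → Unique (step cs R)
step-unique cs R = deduplicate-! _

step-closed : ∀ cs R → Unique R → Closed cs R → step cs R ≡ R
step-closed cs R u closed = begin
  dedup (R ++ new)                        ≡⟨ dedup-++ R new ⟩
  dedup R ++ filter (_∉? R) (dedup new)   ≡⟨ cong₂ _++_ (dedup-unique R u)
                                                        (Listₚ.filter-none (_∉? R) (All.tabulate old)) ⟩
  R ++ []                                 ≡⟨ Listₚ.++-identityʳ R ⟩
  R                                       ∎
  where
  open ≡.≡-Reasoning
  new = concatMap (λ z → map (λ c → c z) cs) R
  old : ∀ {z} → z ∈ dedup new → ¬ (z ∉ R)
  old m z∉R = z∉R (step-⊆ cs closed (λ z∈R → z∈R) z∈step)
    where z∈step = ∈ₚ.∈-deduplicate⁺ _≟_ (∈ₚ.∈-++⁺ʳ R (∈ₚ.∈-deduplicate⁻ _≟_ new m))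

closeK-suc : ∀ k cs R → closeK (suc k) cs R ≡ step cs (closeK k cs R)
closeK-suc zero    cs R = refl
closeK-suc (suc k) cs R = closeK-suc k cs (step cs R)

closeK-+ : ∀ m n cs R → closeK (m ℕ.+ n) cs R ≡ closeK n cs (closeK m cs R)
closeK-+ zero    n cs R = refl
closeK-+ (suc m) n cs R = closeK-+ m n cs (step cs R)

closeK-closed : ∀ k cs R → Unique R → Closed cs R → closeK k cs R ≡ R
closeK-closed zero    cs R u closed = refl
closeK-closed (suc k) cs R u closed rewrite step-closed cs R u closed = closeK-closed k cs R u closed

closeK-unique : ∀ k cs R → Unique R → Unique (closeK k cs R)
closeK-unique zero    cs R u = u
closeK-unique (suc k) cs R u = closeK-unique k cs (step cs R) (step-unique cs R)

closeK-⊇ : ∀ k cs R {z} → z ∈ R → z ∈ closeK k cs R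
closeK-⊇ zero    cs R m = m
closeK-⊇ (suc k) cs R m = closeK-⊇ k cs (step cs R) (∈-step⁺ˡ cs R m)

closeK-preserves : ∀ (Inv : ℕ → Set) k cs R → (∀ {y z} → Inv y → Step cs y z → Inv z) →
                   (∀ {z} → z ∈ R → Inv z) → ∀ {z} → z ∈ closeK k cs R → Inv z
closeK-preserves Inv zero    cs R pres init m = init m
closeK-preserves Inv (suc k) cs R pres init m = closeK-preserves Inv k cs (step cs R) pres init′ m
  where
  init′ : ∀ {z} → z ∈ step cs R → Inv z
  init′ m′ with ∈-step⁻ cs R m′
  ... | inj₁ z∈R           = init z∈R
  ... | inj₂ (y , y∈R , s) = pres (init y∈R) s

closeK-closed-or-grows : ∀ cs x k → Closed cs (closeK k cs (x ∷ [])) ⊎ suc k ≤ length (closeK k cs (x ∷ []))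
closeK-closed-or-grows cs x zero = inj₂ (s≤s z≤n)
closeK-closed-or-grows cs x (suc k) with closed? cs (closeK k cs (x ∷ [])) | closeK-closed-or-grows cs x k
... | inj₁ closed | _ =
  inj₁ (subst (Closed cs) (sym (trans (closeK-suc k cs (x ∷ [])) (step-closed cs R uR closed))) closed)
  where
  R = closeK k cs (x ∷ [])
  uR = closeK-unique k cs (x ∷ []) ([] ∷ [])
... | inj₂ (y , z , y∈R , s , z∉R) | inj₁ closed = ⊥-elim (z∉R (closed y∈R s))
... | inj₂ (y , z , y∈R , s , z∉R) | inj₂ grows =
  inj₂ (subst (λ L → suc (suc k) ≤ length L) (sym (closeK-suc k cs (x ∷ [])))
          (ℕₚ.≤-trans (s≤s grows) (unique-⊆⇒length≤ (All.tabulate z≢ ∷ uR) (step-unique cs R) ⊆step)))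
  where
  R = closeK k cs (x ∷ [])
  uR = closeK-unique k cs (x ∷ []) ([] ∷ [])
  z≢ : ∀ {w} → w ∈ R → z ≢ w
  z≢ w∈R refl = z∉R w∈R
  ⊆step : ∀ {w} → w ∈ z ∷ R → w ∈ step cs R
  ⊆step (here refl) = ∈-step⁺ʳ cs R y∈R s
  ⊆step (there m)   = ∈-step⁺ˡ cs R m

∈-closeK⇒Reach : ∀ k cs x {y} → y ∈ closeK k cs (x ∷ []) → Reach cs x y
∈-closeK⇒Reach k cs x = closeK-preserves (Reach cs x) k cs (x ∷ []) _▷_ λ { (here refl) → ε }

closeK-⊆ : ∀ k cs {V} x → Closed cs V → x ∈ V → ∀ {y} → y ∈ closeK k cs (x ∷ []) → y ∈ V
closeK-⊆ k cs x closed x∈V = closeK-preserves (_∈ _) k cs (x ∷ []) closed λ { (here refl) → x∈V }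

module Saturation (cs : List (ℕ → ℕ)) {V : List ℕ} (uV : Unique V) (closedV : Closed cs V)
                  {x : ℕ} (x∈V : x ∈ V) where

  private
    unique : ∀ k → Unique (closeK k cs (x ∷ []))
    unique k = closeK-unique k cs (x ∷ []) ([] ∷ [])

  closeK-length-closed : Closed cs (closeK (length V) cs (x ∷ []))
  closeK-length-closed with closeK-closed-or-grows cs x (length V)
  ... | inj₁ closed = closed
  ... | inj₂ grows  = ⊥-elim (ℕₚ.<-irrefl refl
          (ℕₚ.≤-trans grows (unique-⊆⇒length≤ (unique (length V)) uV (closeK-⊆ (length V) cs x closedV x∈V))))

  closeK-stable : ∀ k → length V ≤ k → closeK k cs (x ∷ []) ≡ closeK (length V) cs (x ∷ [])
  closeK-stable k V≤k with ℕₚ.m≤n⇒∃[o]m+o≡n V≤k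
  ... | (j , refl) = trans (closeK-+ (length V) j cs (x ∷ []))
                           (closeK-closed j cs _ (unique (length V)) closeK-length-closed)

  Reach⇒∈-closeK : ∀ k → length V ≤ k → ∀ {y} → Reach cs x y → y ∈ closeK k cs (x ∷ [])
  Reach⇒∈-closeK k V≤k r rewrite closeK-stable k V≤k =
    Reach-closed closeK-length-closed (closeK-⊇ (length V) cs (x ∷ []) (here refl)) r

module Orbits (V : List ℕ) (uV : Unique V) (cs : List (ℕ → ℕ)) (inv : All (InvolutionOn V) cs) where

  private
    closed : Closed cs V
    closed = involutions-closed inv

  orbitOf : ℕ → List ℕ
  orbitOf x = closeK (length V) cs (x ∷ [])

  ∈-orbit⇒Reach : ∀ {x y} → y ∈ orbitOf x → Reach cs x y
  ∈-orbit⇒Reach {x} = ∈-closeK⇒Reach (length V) cs x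

  Reach⇒∈-orbit : ∀ {x y} → x ∈ V → Reach cs x y → y ∈ orbitOf x
  Reach⇒∈-orbit x∈V = Saturation.Reach⇒∈-closeK cs uV closed x∈V (length V) ℕₚ.≤-refl

  orbit-self : ∀ {x} → x ∈ V → x ∈ orbitOf x
  orbit-self x∈V = Reach⇒∈-orbit x∈V ε

  orbit-⊆ : ∀ {x y} → x ∈ V → y ∈ orbitOf x → y ∈ V
  orbit-⊆ {x} x∈V = closeK-⊆ (length V) cs x closed x∈V

  orbit-∼ : ∀ {x y} → x ∈ V → y ∈ orbitOf x → orbitOf y ∼[ set ] orbitOf x
  orbit-∼ x∈V y∈ = mk⇔
    (λ z∈ → Reach⇒∈-orbit x∈V (∈-orbit⇒Reach y∈ ◅◅ ∈-orbit⇒Reach z∈))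
    (λ z∈ → Reach⇒∈-orbit (orbit-⊆ x∈V y∈)
                          (Reach-sym inv x∈V (∈-orbit⇒Reach y∈) ◅◅ ∈-orbit⇒Reach z∈))

  orbit-unique : ∀ x → Unique (orbitOf x)
  orbit-unique x = closeK-unique (length V) cs (x ∷ []) ([] ∷ [])

AgreeOn : List ℕ → (ℕ → ℕ) → (ℕ → ℕ) → Set
AgreeOn V c c′ = ∀ {x} → x ∈ V → c x ≡ c′ x

images-cong : ∀ {V cs cs′ z} → Pointwise (AgreeOn V) cs cs′ → z ∈ V →
              map (λ c → c z) cs ≡ map (λ c → c z) cs′
images-cong []         z∈V = refl
images-cong (c≗ ∷ cs≗) z∈V = cong₂ _∷_ (c≗ z∈V) (images-cong cs≗ z∈V)

step-cong : ∀ {V cs cs′} → Pointwise (AgreeOn V) cs cs′ → ∀ R → (∀ {z} → z ∈ R → z ∈ V) →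
            step cs R ≡ step cs′ R
step-cong cs≗ R R⊆V =
  cong (λ L → dedup (R ++ concat L)) (Listₚ.map-cong-local (All.tabulate (λ m → images-cong cs≗ (R⊆V m))))

closeK-cong : ∀ {V cs cs′} → Pointwise (AgreeOn V) cs cs′ → Closed cs V →
              ∀ k R → (∀ {z} → z ∈ R → z ∈ V) → closeK k cs R ≡ closeK k cs′ R
closeK-cong cs≗ closed zero R R⊆V = refl
closeK-cong {cs = cs} cs≗ closed (suc k) R R⊆V rewrite sym (step-cong cs≗ R R⊆V) =
  closeK-cong cs≗ closed k (step cs R) (step-⊆ cs closed R⊆V)


-- Counting classes by their least elements

record IsClassMap (V : List ℕ) (cl : ℕ → List ℕ) : Set where
  field
    self : ∀ {x} → x ∈ V → x ∈ cl x
    ⊆V   : ∀ {x y} → x ∈ V → y ∈ cl x → y ∈ V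
    same : ∀ {x y} → x ∈ V → y ∈ cl x → cl y ∼[ set ] cl x

module _ (V : List ℕ) (uV : Unique V) (cs : List (ℕ → ℕ)) (inv : All (InvolutionOn V) cs) where
  open Orbits V uV cs inv

  orbits-isClassMap : IsClassMap V orbitOf
  orbits-isClassMap = record { self = orbit-self ; ⊆V = orbit-⊆ ; same = orbit-∼ }

IsRep : ∀ {r} → (ℕ → List ℕ) → Pred ℕ r → ℕ → Set r
IsRep cl R x = IsMin x (cl x) × All R (cl x)

isRep? : ∀ {r} {R : Pred ℕ r} (cl : ℕ → List ℕ) → Decidable R → Decidable (IsRep cl R)
isRep? cl R? x = isMin? x (cl x) ×-dec All.all? R? (cl x)

classCount : ∀ {r} {R : Pred ℕ r} → (ℕ → List ℕ) → Decidable R → List ℕ → ℕ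
classCount cl R? V = length (filter (isRep? cl R?) V)

module ClassCount {p q} {P : Pred ℕ p} {Q : Pred ℕ q} (P? : Decidable P) (Q? : Decidable Q)
  {V : List ℕ} (uV : Unique V) {cl cl′ : ℕ → List ℕ} (isClassMap : IsClassMap V cl)
  (cl′-restricts : ∀ {x} → x ∈ V → P x → cl′ x ∼[ set ] filter P? (cl x))
  (¬P⇒Q : ∀ {x} → x ∈ V → ¬ P x → Q x) where
  open IsClassMap isClassMap

  ¬P? : Decidable (λ x → ¬ P x)
  ¬P? x = ¬? (P? x)

  W W̄ : List ℕ
  W = filter P? V
  W̄ = filter ¬P? V

  uW : Unique W
  uW = Uniqueₚ.filter⁺ P? uV

  uW̄ : Unique W̄
  uW̄ = Uniqueₚ.filter⁺ ¬P? uV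

  ∈W⁻ : ∀ {x} → x ∈ W → x ∈ V × P x
  ∈W⁻ = ∈ₚ.∈-filter⁻ P? {xs = V}

  ∈W̄⁻ : ∀ {x} → x ∈ W̄ → x ∈ V × ¬ P x
  ∈W̄⁻ = ∈ₚ.∈-filter⁻ ¬P? {xs = V}

  cl′⊆ : ∀ {x y} → x ∈ V → P x → y ∈ cl′ x → y ∈ cl x × P y
  cl′⊆ x∈V px m = ∈ₚ.∈-filter⁻ P? (to (cl′-restricts x∈V px) m)

  cl′⊇ : ∀ {x y} → x ∈ V → P x → y ∈ cl x → P y → y ∈ cl′ x
  cl′⊇ x∈V px m py = from (cl′-restricts x∈V px) (∈ₚ.∈-filter⁺ P? m py)

  All-cl′⇒All-cl : ∀ {x} → x ∈ V → P x → All Q (cl′ x) → All Q (cl x)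
  All-cl′⇒All-cl {x} x∈V px all-cl′ = All.tabulate λ {y} m → case P? y of λ where
    (yes py) → All.lookup all-cl′ (cl′⊇ x∈V px m py)
    (no ¬py) → ¬P⇒Q (⊆V x∈V m) ¬py

  Meets? : Decidable (λ x → Any P (cl x))
  Meets? x = Any.any? P? (cl x)

  Least? : Decidable (λ x → IsMin x (cl x))
  Least? x = isMin? x (cl x)

  xs ys : List ℕ
  xs = filter (λ x → isRep? cl′ Q? x ×-dec ¬? (Least? x)) W
  ys = filter (λ x → isRep? cl Q? x ×-dec Meets? x) W̄

  f h : ℕ → ℕ
  f x = minimum (cl x)
  h y = minimum (filter P? (cl y))

  module _ {x} (x∈xs : x ∈ xs) where
    private
      x∈W×rep′ : x ∈ W × (IsRep cl′ Q x × ¬ IsMin x (cl x))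
      x∈W×rep′ = ∈ₚ.∈-filter⁻ (λ x → isRep? cl′ Q? x ×-dec ¬? (Least? x)) {xs = W} x∈xs
      x-rep′ = proj₂ x∈W×rep′
      x∈V : x ∈ V
      x∈V = proj₁ (∈W⁻ (proj₁ x∈W×rep′))
      px : P x
      px = proj₂ (∈W⁻ (proj₁ x∈W×rep′))
      fx∈cl : f x ∈ cl x
      fx∈cl = minimum-∈ (cl x) (self x∈V)
      cl-fx∼ : cl (f x) ∼[ set ] cl x
      cl-fx∼ = same x∈V fx∈cl

    f∈ys : f x ∈ ys
    f∈ys = ∈ₚ.∈-filter⁺ (λ x → isRep? cl Q? x ×-dec Meets? x) {xs = W̄}
      (∈ₚ.∈-filter⁺ ¬P? (⊆V x∈V fx∈cl) ¬pfx) ((fx-min , all-Q) , meets)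
      where
      fx-min : IsMin (f x) (cl (f x))
      fx-min = All.tabulate λ m → minimum-≤ (cl x) (to cl-fx∼ m)
      all-Q : All Q (cl (f x))
      all-Q = All.tabulate λ m →
        All.lookup (All-cl′⇒All-cl x∈V px (proj₂ (proj₁ x-rep′))) (to cl-fx∼ m)
      meets : Any P (cl (f x))
      meets = Any.map (λ { refl → px }) (from cl-fx∼ (self x∈V))
      ¬pfx : ¬ P (f x)
      ¬pfx pfx = proj₂ x-rep′ (subst (λ z → IsMin z (cl x)) fx≡x (minimum-isMin (cl x)))
        where
        fx≡x : f x ≡ x
        fx≡x = ℕₚ.≤-antisym (minimum-≤ (cl x) (self x∈V))
                            (All.lookup (proj₁ (proj₁ x-rep′)) (cl′⊇ x∈V px fx∈cl pfx))

    hf : h (f x) ≡ x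
    hf = begin
      minimum (filter P? (cl (f x)))
        ≡⟨ minimum-∼set (filter P? (cl (f x))) (cl′ x) x∈
             (∼set-trans (filter⁺-∼set P? cl-fx∼) (∼set-sym (cl′-restricts x∈V px))) ⟩
      minimum (cl′ x)
        ≡⟨ isMin⇒minimum≡ (cl′ x) (cl′⊇ x∈V px (self x∈V) px) (proj₁ (proj₁ x-rep′)) ⟩
      x
        ∎
      where
      open ≡.≡-Reasoning
      x∈ : x ∈ filter P? (cl (f x))
      x∈ = ∈ₚ.∈-filter⁺ P? (from cl-fx∼ (self x∈V)) px

  module _ {y} (y∈ys : y ∈ ys) where
    private
      y∈W̄×rep : y ∈ W̄ × (IsRep cl Q y × Any P (cl y))
      y∈W̄×rep = ∈ₚ.∈-filter⁻ (λ x → isRep? cl Q? x ×-dec Meets? x) {xs = W̄} y∈ys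
      y∈W̄ = proj₁ y∈W̄×rep
      y-rep = proj₂ y∈W̄×rep
      y∈V : y ∈ V
      y∈V = proj₁ (∈W̄⁻ y∈W̄)
      some∈P : ∃ λ z → z ∈ filter P? (cl y)
      some∈P = let (z , z∈ , pz) = find (proj₂ y-rep) in z , ∈ₚ.∈-filter⁺ P? z∈ pz
      hy∈ : h y ∈ cl y × P (h y)
      hy∈ = ∈ₚ.∈-filter⁻ P? {xs = cl y} (minimum-∈ (filter P? (cl y)) (proj₂ some∈P))
      hy∈V : h y ∈ V
      hy∈V = ⊆V y∈V (proj₁ hy∈)
      cl-hy∼ : cl (h y) ∼[ set ] cl y
      cl-hy∼ = same y∈V (proj₁ hy∈)

    h∈xs : h y ∈ xs
    h∈xs = ∈ₚ.∈-filter⁺ (λ x → isRep? cl′ Q? x ×-dec ¬? (Least? x)) {xs = W}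
      (∈ₚ.∈-filter⁺ P? hy∈V (proj₂ hy∈)) ((hy-min′ , all-Q) , ¬hy-min)
      where
      hy-min′ : IsMin (h y) (cl′ (h y))
      hy-min′ = All.tabulate λ m → let (m′ , pz) = cl′⊆ hy∈V (proj₂ hy∈) m in
        minimum-≤ (filter P? (cl y)) (∈ₚ.∈-filter⁺ P? (to cl-hy∼ m′) pz)
      all-Q : All Q (cl′ (h y))
      all-Q = All.tabulate λ m →
        All.lookup (proj₂ (proj₁ y-rep)) (to cl-hy∼ (proj₁ (cl′⊆ hy∈V (proj₂ hy∈) m)))
      ¬hy-min : ¬ IsMin (h y) (cl (h y))
      ¬hy-min hy-min = proj₂ (∈W̄⁻ y∈W̄) (subst P (sym y≡hy) (proj₂ hy∈))
        where
        y≡hy : y ≡ h y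
        y≡hy = ℕₚ.≤-antisym (All.lookup (proj₁ (proj₁ y-rep)) (proj₁ hy∈))
                            (All.lookup hy-min (from cl-hy∼ (self y∈V)))

    fh : f (h y) ≡ y
    fh = trans (minimum-∼set (cl (h y)) (cl y) (self hy∈V) cl-hy∼)
               (isMin⇒minimum≡ (cl y) (self y∈V) (proj₁ (proj₁ y-rep)))

  -- x ↦ least element of cl x and y ↦ least P-element of cl y are mutually inverse between
  -- the cl′-representatives that are not cl-least and the cl-representatives outside P whose class meets P.
  nonLeast-reps≡meeting-reps : length xs ≡ length ys
  nonLeast-reps≡meeting-reps =
    length-bijection xs ys (Uniqueₚ.filter⁺ _ uW) (Uniqueₚ.filter⁺ _ uW̄) f h f∈ys h∈xs hf fh

  classCount-split : classCount cl Q? V ≡ classCount cl′ Q? W ℕ.+ classCount cl ¬P? W̄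
  classCount-split = begin
    count rep? V
      ≡⟨ length-filter-split rep? P? V ⟩
    count (λ x → rep? x ×-dec P? x) V ℕ.+ count (λ x → rep? x ×-dec ¬P? x) V
      ≡⟨ cong₂ ℕ._+_ (cong length (filter-filter rep? P? V)) (cong length (filter-filter rep? ¬P? V)) ⟨
    count rep? W ℕ.+ count rep? W̄
      ≡⟨ cong₂ ℕ._+_ (length-filter-cong-∈ _ _ W ⇒least ⇐least) (length-filter-split rep? Meets? W̄) ⟩
    count rep′∧least? W ℕ.+ (length ys ℕ.+ count rep∧apart? W̄)
      ≡⟨ cong (λ n → count rep′∧least? W ℕ.+ (n ℕ.+ count rep∧apart? W̄)) nonLeast-reps≡meeting-reps ⟨
    count rep′∧least? W ℕ.+ (length xs ℕ.+ count rep∧apart? W̄)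
      ≡⟨ ℕₚ.+-assoc (count rep′∧least? W) (length xs) _ ⟨
    (count rep′∧least? W ℕ.+ length xs) ℕ.+ count rep∧apart? W̄
      ≡⟨ cong₂ ℕ._+_ (length-filter-split (isRep? cl′ Q?) Least? W)
                     (length-filter-cong-∈ _ _ W̄ ⇐apart ⇒apart) ⟨
    count (isRep? cl′ Q?) W ℕ.+ count (isRep? cl ¬P?) W̄
      ∎
    where
    open ≡.≡-Reasoning
    count : ∀ {r} {R : Pred ℕ r} → Decidable R → List ℕ → ℕ
    count R? zs = length (filter R? zs)
    rep? = isRep? cl Q?
    rep′∧least? = λ x → isRep? cl′ Q? x ×-dec Least? x
    rep∧apart? = λ x → rep? x ×-dec ¬? (Meets? x)
    ⇒least : ∀ x → x ∈ W → IsRep cl Q x → IsRep cl′ Q x × IsMin x (cl x)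
    ⇒least x x∈W (x-min , all-Q) = (restrict-All x-min , restrict-All all-Q) , x-min
      where
      restrict-All : ∀ {r} {R : Pred ℕ r} → All R (cl x) → All R (cl′ x)
      restrict-All all = All.tabulate λ m → All.lookup all (proj₁ (uncurry cl′⊆ (∈W⁻ x∈W) m))
    ⇐least : ∀ x → x ∈ W → IsRep cl′ Q x × IsMin x (cl x) → IsRep cl Q x
    ⇐least x x∈W ((_ , all-Q′) , x-min) = x-min , uncurry All-cl′⇒All-cl (∈W⁻ x∈W) all-Q′
    ⇒apart : ∀ x → x ∈ W̄ → IsRep cl Q x × ¬ Any P (cl x) → IsRep cl (λ y → ¬ P y) x
    ⇒apart x _ ((x-min , _) , ¬meets) = x-min , Allₚ.¬Any⇒All¬ (cl x) ¬meets
    ⇐apart : ∀ x → x ∈ W̄ → IsRep cl (λ y → ¬ P y) x → IsRep cl Q x × ¬ Any P (cl x)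
    ⇐apart x x∈W̄ (x-min , all¬P) =
      (x-min , All.tabulate (λ m → ¬P⇒Q (⊆V (proj₁ (∈W̄⁻ x∈W̄)) m) (All.lookup all¬P m))) ,
      Allₚ.All¬⇒¬Any all¬P

classCount-inside : (F U : List ℕ) (cl : ℕ → List ℕ) → Unique F → Unique U → (∀ {y} → y ∈ U → y ∈ F) →
                    classCount cl (λ y → ¬? (y ∉? U)) (filter (λ y → ¬? (y ∉? U)) F) ≡ classCount cl (_∈? U) U
classCount-inside F U cl uF uU U⊆F =
  trans (length-filter-∼set (isRep? cl ¬∉?) (Uniqueₚ.filter⁺ ¬∉? uF) uU
           (mk⇔ (λ m → ¬¬∈ (proj₂ (∈ₚ.∈-filter⁻ ¬∉? {xs = F} m)))
                (λ m → ∈ₚ.∈-filter⁺ ¬∉? (U⊆F m) (λ y∉U → y∉U m))))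
        (length-filter-cong-∈ _ _ U (λ _ _ (x-min , all) → x-min , All.map ¬¬∈ all)
                                    (λ _ _ (x-min , all) → x-min , All.map (λ m y∉U → y∉U m) all))
  where
  ¬∉? : Decidable (λ y → ¬ (y ∉ U))
  ¬∉? y = ¬? (y ∉? U)
  ¬¬∈ : ∀ {y} → ¬ (y ∉ U) → y ∈ U
  ¬¬∈ = decidable-stable (_ ∈? U)


-- Walks through a set of suppressed vertices

-- The g-edge at a vertex x ∉ U is extended through U by alternating σ and g, until it leaves U;
-- its end is ĝ x, the g-neighbour of x once the vertices of U are suppressed.
module Splice (V : List ℕ) (uV : Unique V) (U : List ℕ) (g σ : ℕ → ℕ)
              (g-inv : InvolutionOn V g) (σ-inv : InvolutionOn V σ)
              (σ-U : ∀ {x} → x ∈ V → x ∈ U → σ x ∈ U) where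

  hop : ℕ → ℕ
  hop y = g (σ y)

  hop-∈V : ∀ {y} → y ∈ V → hop y ∈ V
  hop-∈V y∈V = proj₁ (g-inv (proj₁ (σ-inv y∈V)))

  data Exit : ℕ → ℕ → ℕ → Set where
    leave : ∀ {y} → y ∉ U → Exit 0 y y
    hopin : ∀ {n y w} → y ∈ U → Exit n (hop y) w → Exit (suc n) y w

  Exits : ℕ → ℕ → Set
  Exits y w = ∃ λ n → Exit n y w

  Exit-∈V : ∀ {n y w} → y ∈ V → Exit n y w → w ∈ V
  Exit-∈V y∈V (leave _)   = y∈V
  Exit-∈V y∈V (hopin _ e) = Exit-∈V (hop-∈V y∈V) e

  Exit-∉U : ∀ {n y w} → Exit n y w → w ∉ U
  Exit-∉U (leave w∉U) = w∉U
  Exit-∉U (hopin _ e) = Exit-∉U e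

  Exit-functional : ∀ {n m y w w′} → Exit n y w → Exit m y w′ → w ≡ w′
  Exit-functional (leave _)     (leave _)     = refl
  Exit-functional (leave y∉U)   (hopin y∈U _) = ⊥-elim (y∉U y∈U)
  Exit-functional (hopin y∈U _) (leave y∉U)   = ⊥-elim (y∉U y∈U)
  Exit-functional (hopin _ e)   (hopin _ e′)  = Exit-functional e e′

  Exit⇒spliceWalk : ∀ {n y w} k → Exit n y w → n ≤ k → spliceWalk k U g σ y ≡ w
  Exit⇒spliceWalk zero (leave _) _ = refl
  Exit⇒spliceWalk {y = y} (suc k) (leave y∉U) _ with y ∈? U
  ... | yes y∈U = ⊥-elim (y∉U y∈U)
  ... | no _    = refl
  Exit⇒spliceWalk {y = y} (suc k) (hopin y∈U e) (s≤s n≤k) with y ∈? U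
  ... | yes _   = Exit⇒spliceWalk k e n≤k
  ... | no y∉U  = ⊥-elim (y∉U y∈U)

  Exits-leave⁻ : ∀ {y t} → y ∉ U → Exits y t → t ≡ y
  Exits-leave⁻ y∉U (_ , e) = sym (Exit-functional (leave y∉U) e)

  Exits-hop⁻ : ∀ {y t} → y ∈ U → Exits y t → Exits (hop y) t
  Exits-hop⁻ y∈U (_ , leave y∉U) = ⊥-elim (y∉U y∈U)
  Exits-hop⁻ y∈U (_ , hopin _ e) = _ , e

  ĝ : ℕ → ℕ
  ĝ x = spliceWalk (length V) U g σ (g x)

  hops : ℕ → ℕ → ℕ
  hops y zero    = y
  hops y (suc k) = hops (hop y) k

  hops-suc : ∀ y k → hops y (suc k) ≡ hop (hops y k)
  hops-suc y zero    = refl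
  hops-suc y (suc k) = hops-suc (hop y) k

  hops-∈V : ∀ {y} k → y ∈ V → hops y k ∈ V
  hops-∈V zero    y∈V = y∈V
  hops-∈V (suc k) y∈V = hops-∈V k (hop-∈V y∈V)

  hops-exit : ∀ j y → (∀ k → k < j → hops y k ∈ U) → hops y j ∉ U → Exit j y (hops y j)
  hops-exit zero    y in-U out = leave out
  hops-exit (suc j) y in-U out =
    hopin (in-U 0 (s≤s z≤n)) (hops-exit j (hop y) (λ k k<j → in-U (suc k) (s≤s k<j)) out)

  module _ {x : ℕ} (x∈V : x ∈ V) (x∉U : x ∉ U) where
    private
      it : ℕ → ℕ
      it = hops (g x)

      it-∈V : ∀ k → it k ∈ V
      it-∈V k = hops-∈V k (proj₁ (g-inv x∈V))

      unhop : ∀ k → σ (g (it (suc k))) ≡ it k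
      unhop k = begin
        σ (g (it (suc k)))         ≡⟨ cong (σ ∘ g) (hops-suc (g x) k) ⟩
        σ (g (g (σ (it k))))       ≡⟨ cong σ (proj₂ (g-inv (proj₁ (σ-inv (it-∈V k))))) ⟩
        σ (σ (it k))               ≡⟨ proj₂ (σ-inv (it-∈V k)) ⟩
        it k                       ∎
        where open ≡.≡-Reasoning

      -- Undoing hops reduces a repetition to g x = it (suc j), which would put x = σ (it j) in U.
      it-injective : ∀ m → (∀ k → k < m → it k ∈ U) → ∀ {i j} → i < j → j < m → it i ≢ it j
      it-injective m in-U {zero} {suc j} _ j<m it0≡ =
        x∉U (subst (_∈ U) σit≡x (σ-U (it-∈V j) (in-U j (ℕₚ.<-trans (ℕₚ.n<1+n j) j<m))))
        where
        σit≡x : σ (it j) ≡ x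
        σit≡x = begin
          σ (it j)                  ≡⟨ proj₂ (g-inv (proj₁ (σ-inv (it-∈V j)))) ⟨
          g (g (σ (it j)))          ≡⟨ cong g (hops-suc (g x) j) ⟨
          g (it (suc j))            ≡⟨ cong g it0≡ ⟨
          g (g x)                   ≡⟨ proj₂ (g-inv x∈V) ⟩
          x                         ∎
          where open ≡.≡-Reasoning
      it-injective m in-U {suc i} {suc j} (s≤s i<j) j<m it≡ =
        it-injective m in-U i<j (ℕₚ.<-trans (ℕₚ.n<1+n j) j<m)
                     (trans (sym (unhop i)) (trans (cong (σ ∘ g) it≡) (unhop j)))

      first-exit : ∀ m → (∀ k → k < m → it k ∈ U) ⊎
                         (∃ λ j → j < m × it j ∉ U × (∀ k → k < j → it k ∈ U))
      first-exit zero = inj₁ (λ k ())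
      first-exit (suc m) with first-exit m
      ... | inj₂ (j , j<m , out , in-U) = inj₂ (j , ℕₚ.m<n⇒m<1+n j<m , out , in-U)
      ... | inj₁ in-U with it m ∈? U
      ...   | no out    = inj₂ (m , ℕₚ.n<1+n m , out , in-U)
      ...   | yes itm∈U = inj₁ λ k k<1+m → case ℕₚ.m≤n⇒m<n∨m≡n (ℕₚ.≤-pred k<1+m) of λ where
                (inj₁ k<m)  → in-U k k<m
                (inj₂ refl) → itm∈U

    exit-ĝ : Exits (g x) (ĝ x)
    exit-ĝ with first-exit (length V)
    ... | inj₂ (j , j<V , out , in-U) =
      j , subst (Exit j (g x)) (sym (Exit⇒spliceWalk (length V) e (ℕₚ.<⇒≤ j<V))) e
      where e = hops-exit j (g x) in-U out
    ... | inj₁ in-U = ⊥-elim (ℕₚ.<-irrefl refl (begin-strict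
      length V                                  ≡⟨ Listₚ.length-applyUpTo it (length V) ⟨
      length (applyUpTo it (length V))         <⟨ ℕₚ.n<1+n _ ⟩
      length (x ∷ applyUpTo it (length V))     ≤⟨ unique-⊆⇒length≤ unique uV ⊆V ⟩
      length V                                  ∎))
      where
      open ℕₚ.≤-Reasoning
      unique : Unique (x ∷ applyUpTo it (length V))
      unique = All.tabulate (λ m x≡ → let (k , k<V , z≡) = ∈ₚ.∈-applyUpTo⁻ it m in
                                       x∉U (subst (_∈ U) (sym (trans x≡ z≡)) (in-U k k<V)))
               ∷ Uniqueₚ.applyUpTo⁺₁ it (length V) (it-injective (length V) in-U)
      ⊆V : ∀ {z} → z ∈ x ∷ applyUpTo it (length V) → z ∈ V
      ⊆V (here refl) = x∈V
      ⊆V (there m)   = let (k , _ , z≡) = ∈ₚ.∈-applyUpTo⁻ it m in subst (_∈ V) (sym z≡) (it-∈V k)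

    ĝ-∈V : ĝ x ∈ V
    ĝ-∈V = Exit-∈V (proj₁ (g-inv x∈V)) (proj₂ exit-ĝ)

    ĝ-∉U : ĝ x ∉ U
    ĝ-∉U = Exit-∉U (proj₂ exit-ĝ)

  Exits-σ⇔g : ∀ {y t} → y ∈ V → y ∈ U → (Exits (σ y) t → Exits (g y) t) × (Exits (g y) t → Exits (σ y) t)
  Exits-σ⇔g y∈V y∈U =
    (λ e → subst (λ z → Exits (g z) _) σσy≡y (Exits-hop⁻ (σ-U y∈V y∈U) e)) ,
    (λ (n , e) → suc n , hopin (σ-U y∈V y∈U) (subst (λ z → Exit n (g z) _) (sym σσy≡y) e))
    where σσy≡y = proj₂ (σ-inv y∈V)

  Exits-along : ∀ {n y w} → y ∈ V → Exit n y w →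
                ∀ t → (Exits (g w) t → Exits (g y) t) × (Exits (g y) t → Exits (g w) t)
  Exits-along y∈V (leave _) t = (λ e → e) , (λ e → e)
  Exits-along {y = y} y∈V (hopin y∈U e) t =
    (λ ew → proj₁ (Exits-σ⇔g y∈V y∈U) (subst (λ z → Exits z t) gg≡ (proj₁ ih ew))) ,
    (λ ey → proj₂ ih (subst (λ z → Exits z t) (sym gg≡) (proj₂ (Exits-σ⇔g y∈V y∈U) ey)))
    where
    ih = Exits-along (hop-∈V y∈V) e t
    gg≡ : g (hop y) ≡ σ y
    gg≡ = proj₂ (g-inv (proj₁ (σ-inv y∈V)))

  ĝ-involutive : ∀ {x} → x ∈ V → x ∉ U → ĝ (ĝ x) ≡ x
  ĝ-involutive {x} x∈V x∉U = Exits-leave⁻ x∉U (subst (λ z → Exits z (ĝ (ĝ x))) (proj₂ (g-inv x∈V)) back)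
    where
    back : Exits (g (g x)) (ĝ (ĝ x))
    back = proj₁ (Exits-along (proj₁ (g-inv x∈V)) (proj₂ (exit-ĝ x∈V x∉U)) _)
                 (exit-ĝ (ĝ-∈V x∈V x∉U) (ĝ-∉U x∈V x∉U))

  Exits-next : ∀ {z w} → z ∈ V → z ∈ U → Exits z w → Exits (g z) (ĝ w) × Exits (σ z) (ĝ w)
  Exits-next {z} {w} z∈V z∈U e = proj₁ (Exits-σ⇔g z∈V z∈U) e-σ , e-σ
    where
    e′ = proj₂ (Exits-hop⁻ z∈U e)
    e-σ : Exits (σ z) (ĝ w)
    e-σ = subst (λ y → Exits y (ĝ w)) (proj₂ (g-inv (proj₁ (σ-inv z∈V))))
            (proj₁ (Exits-along (hop-∈V z∈V) e′ (ĝ w)) (exit-ĝ (Exit-∈V (hop-∈V z∈V) e′) (Exit-∉U e′)))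

  -- Off U, τ may differ from σ: SpliceTwice compares the ĝ–c₂-orbits after splicing along e₁ with
  -- the g–τ-orbits for τ = c₁ on e₁ and c₂ elsewhere.
  module Reachability (τ c : ℕ → ℕ)
    (τ-U : ∀ {z} → z ∈ V → z ∈ U → τ z ≡ σ z) (τ-out : ∀ {z} → z ∈ V → z ∉ U → τ z ≡ c z)
    (c-out : ∀ {z} → z ∈ V → z ∉ U → c z ∈ V × c z ∉ U) where

    Outside : ℕ → Set
    Outside z = z ∈ V × z ∉ U

    ĝ-out : ∀ {z} → Outside z → Outside (ĝ z)
    ĝ-out (z∈V , z∉U) = ĝ-∈V z∈V z∉U , ĝ-∉U z∈V z∉U

    τ-∈V : ∀ {z} → z ∈ V → τ z ∈ V
    τ-∈V {z} z∈V with z ∈? U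
    ... | yes z∈U = subst (_∈ V) (sym (τ-U z∈V z∈U)) (proj₁ (σ-inv z∈V))
    ... | no z∉U  = subst (_∈ V) (sym (τ-out z∈V z∉U)) (proj₁ (c-out z∈V z∉U))

    Exit⇒Reach : ∀ {n y w} → y ∈ V → Exit n y w → Reach (g ∷ τ ∷ []) y w
    Exit⇒Reach y∈V (leave _)     = ε
    Exit⇒Reach y∈V (hopin y∈U e) =
      there (here (sym (τ-U y∈V y∈U))) ◅ here refl ◅ Exit⇒Reach (hop-∈V y∈V) e

    spliced⇒Reach : ∀ {x y} → Outside x → Reach (ĝ ∷ c ∷ []) x y → Reach (g ∷ τ ∷ []) x y
    spliced⇒Reach o ε = ε
    spliced⇒Reach o@(x∈V , x∉U) (here refl ◅ r) =
      here refl ◅ Exit⇒Reach (proj₁ (g-inv x∈V)) (proj₂ (exit-ĝ x∈V x∉U)) ◅◅ spliced⇒Reach (ĝ-out o) r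
    spliced⇒Reach (x∈V , x∉U) (there (here refl) ◅ r) =
      there (here (sym (τ-out x∈V x∉U))) ◅ spliced⇒Reach (c-out x∈V x∉U) r

    Linked : ℕ → ℕ → Set
    Linked x z = ∃ λ w → Exits z w × Reach (ĝ ∷ c ∷ []) x w

    Linked-step : ∀ {x z z′} → z ∈ V → Linked x z → Step (g ∷ τ ∷ []) z z′ → Linked x z′
    Linked-step {z = z} z∈V (w , e , r) s with z ∈? U
    Linked-step z∈V (w , e , r) (here refl) | yes z∈U =
      ĝ w , proj₁ (Exits-next z∈V z∈U e) , r ▷ here refl
    Linked-step z∈V (w , e , r) (there (here refl)) | yes z∈U =
      ĝ w , subst (λ y → Exits y (ĝ w)) (sym (τ-U z∈V z∈U)) (proj₂ (Exits-next z∈V z∈U e)) , r ▷ here refl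
    Linked-step z∈V (w , e , r) (here refl) | no z∉U with Exits-leave⁻ z∉U e
    ... | refl = ĝ w , exit-ĝ z∈V z∉U , r ▷ here refl
    Linked-step {z = z} z∈V (w , e , r) (there (here refl)) | no z∉U with Exits-leave⁻ z∉U e
    ... | refl = τ z , (0 , leave τz∉U) , r ▷ there (here (τ-out z∈V z∉U))
      where
      τz∉U : τ z ∉ U
      τz∉U = subst (_∉ U) (sym (τ-out z∈V z∉U)) (proj₂ (c-out z∈V z∉U))

    Linked-Reach : ∀ {x z y} → z ∈ V → Linked x z → Reach (g ∷ τ ∷ []) z y → Linked x y
    Linked-Reach z∈V l ε = l
    Linked-Reach z∈V l (s@(here refl) ◅ r)         = Linked-Reach (proj₁ (g-inv z∈V)) (Linked-step z∈V l s) r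
    Linked-Reach z∈V l (s@(there (here refl)) ◅ r) = Linked-Reach (τ-∈V z∈V) (Linked-step z∈V l s) r

    Reach⇒spliced : ∀ {x y} → Outside x → y ∉ U → Reach (g ∷ τ ∷ []) x y → Reach (ĝ ∷ c ∷ []) x y
    Reach⇒spliced (x∈V , x∉U) y∉U r with Linked-Reach x∈V (_ , (0 , leave x∉U) , ε) r
    ... | (w , e , r′) with Exits-leave⁻ y∉U e
    ... | refl = r′


-- Unlike IsGehm this allows fixed points (loops), which H ∖ₕ e and H /ₕ e may have.
record IsPregehm (G : RawGehm) : Set where
  field
    unique : Unique (flags G)
    b-inv  : InvolutionOn (flags G) (b G)
    g-inv  : InvolutionOn (flags G) (g G)
    r-inv  : InvolutionOn (flags G) (r G)

IsGehm⇒IsPregehm : ∀ {G} → IsGehm G → IsPregehm G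
IsGehm⇒IsPregehm isGehm = record
  { unique = IsGehm.distinct isGehm
  ; b-inv  = λ m → let (bx∈ , _ , bbx≡) = IsGehm.b-ok isGehm _ m in bx∈ , bbx≡
  ; g-inv  = λ m → let (gx∈ , _ , ggx≡) = IsGehm.g-ok isGehm _ m in gx∈ , ggx≡
  ; r-inv  = λ m → let (rx∈ , _ , rrx≡) = IsGehm.r-ok isGehm _ m in rx∈ , rrx≡
  }

countCycles≡classCount : ∀ G cs → countCycles G cs ≡ classCount (orbit G cs) (λ _ → yes tt) (flags G)
countCycles≡classCount G cs =
  length-filter-cong-∈ _ _ (flags G) (λ _ _ x-min → x-min , All.tabulate (λ _ → tt)) (λ _ _ → proj₁)

_≟ₗ_ : (xs ys : List ℕ) → Dec (xs ≡ ys)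
_≟ₗ_ = Listₚ.≡-dec _≟_

removeE : Hyperedge → List Hyperedge → List Hyperedge
removeE e = filter (λ h → ¬? (h ≟ₗ e))

removeE-middle : ∀ pre post e → Unique (pre ++ e ∷ post) → removeE e (pre ++ e ∷ post) ≡ pre ++ post
removeE-middle [] post e (e∉post ∷ _) =
  trans (Listₚ.filter-reject (λ h → ¬? (h ≟ₗ e)) (λ e≢e → e≢e refl))
        (Listₚ.filter-all (λ h → ¬? (h ≟ₗ e)) (All.map (λ e≢h h≡e → e≢h (sym h≡e)) e∉post))
removeE-middle (x ∷ pre) post e (x∉ ∷ u) =
  trans (Listₚ.filter-accept (λ h → ¬? (h ≟ₗ e)) {x} (All.lookup x∉ (∈ₚ.∈-++⁺ʳ pre (here refl))))
        (cong (x ∷_) (removeE-middle pre post e u))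

module Hyperedges (G : RawGehm) (pg : IsPregehm G) where
  open IsPregehm pg

  F : List ℕ
  F = flags G

  br : List (ℕ → ℕ)
  br = b G ∷ r G ∷ []

  open Orbits F unique br (b-inv ∷ r-inv ∷ []) public

  isRep-br? : Decidable (λ x → IsMin x (orbitOf x))
  isRep-br? x = isMin? x (orbitOf x)

  reps : List ℕ
  reps = filter isRep-br? F

  ∈reps⁻ : ∀ {x} → x ∈ reps → x ∈ F × IsMin x (orbitOf x)
  ∈reps⁻ = ∈ₚ.∈-filter⁻ isRep-br? {xs = F}

  reps-injective : ∀ {x x′} → x ∈ F → x′ ∈ F → IsMin x (orbitOf x) → IsMin x′ (orbitOf x′) →
                   x ∈ orbitOf x′ → x ≡ x′
  reps-injective x∈F x′∈F x-min x′-min x∈ =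
    ℕₚ.≤-antisym (All.lookup x-min (from (orbit-∼ x′∈F x∈) (orbit-self x′∈F))) (All.lookup x′-min x∈)

  hyperedges-unique : Unique (hyperedges G)
  hyperedges-unique = map⁺-unique orbitOf (Uniqueₚ.filter⁺ isRep-br? unique) λ ma ma′ ≡orb →
    let (a∈F , a-min) = ∈reps⁻ ma ; (a′∈F , a′-min) = ∈reps⁻ ma′ in
    reps-injective a∈F a′∈F a-min a′-min (subst (_ ∈_) ≡orb (orbit-self a∈F))

  module Edge {e : Hyperedge} (e∈ : e ∈ hyperedges G) where
    private
      rep : ∃ λ x₀ → x₀ ∈ reps × e ≡ orbitOf x₀
      rep = ∈ₚ.∈-map⁻ orbitOf e∈

    x₀ : ℕ
    x₀ = proj₁ rep

    x₀∈reps : x₀ ∈ reps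
    x₀∈reps = proj₁ (proj₂ rep)

    private
      x₀∈F : x₀ ∈ F
      x₀∈F = proj₁ (∈reps⁻ x₀∈reps)
      e≡ : e ≡ orbitOf x₀
      e≡ = proj₂ (proj₂ rep)

      e-closed : Closed br e
      e-closed {y} {z} y∈e s =
        subst (z ∈_) (sym e≡) (Reach⇒∈-orbit x₀∈F (∈-orbit⇒Reach (subst (y ∈_) e≡ y∈e) ▷ s))

    orbit-x₀ : orbitOf x₀ ≡ e
    orbit-x₀ = sym e≡

    x₀∈e : x₀ ∈ e
    x₀∈e = subst (x₀ ∈_) orbit-x₀ (orbit-self x₀∈F)

    e-∼ : ∀ {y} → y ∈ e → orbitOf y ∼[ set ] e
    e-∼ {y} y∈e = subst (λ e′ → orbitOf y ∼[ set ] e′) orbit-x₀ (orbit-∼ x₀∈F (subst (y ∈_) e≡ y∈e))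

    e-unique : Unique e
    e-unique = subst Unique (sym e≡) (orbit-unique x₀)

    e⊆F : ∀ {y} → y ∈ e → y ∈ F
    e⊆F y∈e = orbit-⊆ x₀∈F (subst (_ ∈_) e≡ y∈e)

    e-b : ∀ {y} → y ∈ e → b G y ∈ e
    e-b y∈e = e-closed y∈e (here refl)

    e-r : ∀ {y} → y ∈ e → r G y ∈ e
    e-r y∈e = e-closed y∈e (there (here refl))

    rep∈e⇒orbit≡e : ∀ {x} → x ∈ reps → x ∈ e → orbitOf x ≡ e
    rep∈e⇒orbit≡e {x} x∈reps x∈e = let (x∈F , x-min) = ∈reps⁻ x∈reps in
      trans (cong orbitOf (reps-injective x∈F x₀∈F x-min (proj₂ (∈reps⁻ x₀∈reps)) (subst (x ∈_) e≡ x∈e)))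
            orbit-x₀

    rest : List ℕ
    rest = filter (_∉? e) F

    ∈rest⁻ : ∀ {x} → x ∈ rest → x ∈ F × x ∉ e
    ∈rest⁻ = ∈ₚ.∈-filter⁻ (_∉? e) {xs = F}

    ∈rest⁺ : ∀ {x} → x ∈ F → x ∉ e → x ∈ rest
    ∈rest⁺ = ∈ₚ.∈-filter⁺ (_∉? e)

    rest-unique : Unique rest
    rest-unique = Uniqueₚ.filter⁺ (_∉? e) unique

    rest-inv : ∀ {c} → InvolutionOn F c → (∀ {y} → y ∈ e → c y ∈ e) → InvolutionOn rest c
    rest-inv c-inv c-e m = let (x∈F , x∉e) = ∈rest⁻ m ; (cx∈F , ccx≡) = c-inv x∈F in
      ∈rest⁺ cx∈F (λ cx∈e → x∉e (subst (_∈ e) ccx≡ (c-e cx∈e))) , ccx≡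

    -- The b–r-orbits avoiding e are untouched; the spliced gehm merely computes them with fewer closure steps.
    hyperedges-splice : ∀ c → hyperedges (splice G c e) ≡ removeE e (hyperedges G)
    hyperedges-splice c = begin
      map orbitˢ (filter (λ x → isMin? x (orbitˢ x)) rest)
        ≡⟨ cong (map orbitˢ) (filter-cong-∈ _ isRep-br? rest (λ x m → subst (IsMin x) (orbitˢ≡ m))
                                                             (λ x m → subst (IsMin x) (sym (orbitˢ≡ m)))) ⟩
      map orbitˢ (filter isRep-br? rest)
        ≡⟨ Listₚ.map-cong-local (All.tabulate λ m → orbitˢ≡ (proj₁ (∈ₚ.∈-filter⁻ _ {xs = rest} m))) ⟩
      map orbitOf (filter isRep-br? rest)
        ≡⟨ cong (map orbitOf) (filter-filter isRep-br? (_∉? e) F) ⟩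
      map orbitOf (filter (λ x → isRep-br? x ×-dec x ∉? e) F)
        ≡⟨ cong (map orbitOf) (filter-cong-∈ _ _ F (λ _ _ (p , q) → q , p) (λ _ _ (p , q) → q , p)) ⟩
      map orbitOf (filter (λ x → x ∉? e ×-dec isRep-br? x) F)
        ≡⟨ cong (map orbitOf) (filter-filter (_∉? e) isRep-br? F) ⟨
      map orbitOf (filter (_∉? e) reps)
        ≡⟨ map-filter orbitOf (_∉? e) (λ h → ¬? (h ≟ₗ e)) reps
             (λ x m x∉e orb≡e → x∉e (subst (x ∈_) orb≡e (orbit-self (proj₁ (∈reps⁻ m)))))
             (λ x m orb≢e x∈e → orb≢e (rep∈e⇒orbit≡e m x∈e)) ⟩
      removeE e (hyperedges G)
        ∎
      where
      open ≡.≡-Reasoning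
      orbitˢ : ℕ → List ℕ
      orbitˢ = orbit (splice G c e) br
      orbitˢ≡ : ∀ {x} → x ∈ rest → orbitˢ x ≡ orbitOf x
      orbitˢ≡ x∈rest = sym (Saturation.closeK-stable br rest-unique
        (involutions-closed (rest-inv b-inv e-b ∷ rest-inv r-inv e-r ∷ [])) x∈rest
        (length F) (Listₚ.length-filter (_∉? e) F))

  hyperedges-disjoint : ∀ {e₁ e₂} → e₁ ∈ hyperedges G → e₂ ∈ hyperedges G → e₁ ≢ e₂ →
                        ∀ {y} → ¬ (y ∈ e₁ × y ∈ e₂)
  hyperedges-disjoint {e₂ = e₂} e₁∈ e₂∈ e₁≢e₂ (y∈e₁ , y∈e₂) =
    e₁≢e₂ (trans (sym E₁.orbit-x₀) (E₂.rep∈e⇒orbit≡e E₁.x₀∈reps x₀∈e₂))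
    where
    module E₁ = Edge e₁∈
    module E₂ = Edge e₂∈
    x₀∈e₂ : E₁.x₀ ∈ e₂
    x₀∈e₂ = to (E₂.e-∼ y∈e₂) (from (E₁.e-∼ y∈e₁) E₁.x₀∈e)

PreservesHyperedges : RawGehm → (ℕ → ℕ) → Set
PreservesHyperedges G c = ∀ {e} → e ∈ hyperedges G → ∀ {y} → y ∈ e → c y ∈ e

module _ (G : RawGehm) (pg : IsPregehm G) where

  b-preserves : PreservesHyperedges G (b G)
  b-preserves e∈ = Hyperedges.Edge.e-b G pg e∈

  r-preserves : PreservesHyperedges G (r G)
  r-preserves e∈ = Hyperedges.Edge.e-r G pg e∈

  ∈-hyperedges-splice : ∀ {e h} c → e ∈ hyperedges G → h ∈ hyperedges G → h ≢ e →
                        h ∈ hyperedges (splice G c e)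
  ∈-hyperedges-splice {e} {h} c e∈ h∈ h≢e =
    subst (h ∈_) (sym (Hyperedges.Edge.hyperedges-splice G pg e∈ c))
                 (∈ₚ.∈-filter⁺ (λ h → ¬? (h ≟ₗ e)) h∈ h≢e)


-- Splicing along a hyperedge

-- c is the contracted colour of e: r G for G ∖ₕ e and b G for G /ₕ e.
module SpliceAlong (G : RawGehm) (pg : IsPregehm G) {e : Hyperedge} (e∈ : e ∈ hyperedges G)
                   (c : ℕ → ℕ) (c-inv : InvolutionOn (flags G) c) (c-e : ∀ {y} → y ∈ e → c y ∈ e) where
  open IsPregehm pg
  open Hyperedges G pg using (F)
  open Hyperedges.Edge G pg e∈
  module S = Splice F unique e (g G) c g-inv c-inv (λ _ → c-e)

  ĝ-inv : InvolutionOn rest S.ĝ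
  ĝ-inv m = let (x∈F , x∉e) = ∈rest⁻ m in
    ∈rest⁺ (S.ĝ-∈V x∈F x∉e) (S.ĝ-∉U x∈F x∉e) , S.ĝ-involutive x∈F x∉e

  splice-isPregehm : IsPregehm (splice G c e)
  splice-isPregehm = record
    { unique = rest-unique
    ; b-inv  = rest-inv b-inv e-b
    ; g-inv  = ĝ-inv
    ; r-inv  = rest-inv r-inv e-r
    }

  c-out : ∀ {z} → z ∈ F → z ∉ e → c z ∈ F × c z ∉ e
  c-out z∈F z∉e = proj₁ (c-inv z∈F) , λ cz∈e → z∉e (subst (_∈ e) (proj₂ (c-inv z∈F)) (c-e cz∈e))

  module O  = Orbits F unique (g G ∷ c ∷ []) (g-inv ∷ c-inv ∷ [])
  module Oˢ = Orbits rest rest-unique (S.ĝ ∷ c ∷ []) (ĝ-inv ∷ rest-inv c-inv c-e ∷ [])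
  module R  = S.Reachability c c (λ _ _ → refl) (λ _ _ → refl) c-out

  orbit-splice : ∀ {x} → x ∈ F → x ∉ e → Oˢ.orbitOf x ∼[ set ] filter (_∉? e) (O.orbitOf x)
  orbit-splice x∈F x∉e = mk⇔
    (λ m → ∈ₚ.∈-filter⁺ (_∉? e) (O.Reach⇒∈-orbit x∈F (R.spliced⇒Reach out (Oˢ.∈-orbit⇒Reach m)))
                                (proj₂ (∈rest⁻ (Oˢ.orbit-⊆ (∈rest⁺ x∈F x∉e) m))))
    (λ m → let (m′ , y∉e) = ∈ₚ.∈-filter⁻ (_∉? e) {xs = O.orbitOf _} m in
           Oˢ.Reach⇒∈-orbit (∈rest⁺ x∈F x∉e) (R.Reach⇒spliced out y∉e (O.∈-orbit⇒Reach m′)))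
    where out = x∈F , x∉e

  -- A g–c-cycle meeting e survives, shortened, in the splice; one inside e becomes an isolate.
  countCycles-splice : countCycles G (g G ∷ c ∷ []) ≡
                       countCycles (splice G c e) (S.ĝ ∷ c ∷ []) ℕ.+ insideCycles G c e
  countCycles-splice = begin
    countCycles G (g G ∷ c ∷ [])
      ≡⟨ countCycles≡classCount G (g G ∷ c ∷ []) ⟩
    classCount O.orbitOf ⊤? F
      ≡⟨ ClassCount.classCount-split (_∉? e) ⊤? unique (orbits-isClassMap F unique _ (g-inv ∷ c-inv ∷ []))
                                     orbit-splice (λ _ _ → tt) ⟩
    classCount Oˢ.orbitOf ⊤? rest ℕ.+ classCount O.orbitOf (λ y → ¬? (y ∉? e)) (filter (λ y → ¬? (y ∉? e)) F)
      ≡⟨ cong₂ ℕ._+_ (sym (countCycles≡classCount (splice G c e) (S.ĝ ∷ c ∷ [])))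
                     (classCount-inside F e O.orbitOf unique e-unique e⊆F) ⟩
    countCycles (splice G c e) (S.ĝ ∷ c ∷ []) ℕ.+ insideCycles G c e
      ∎
    where
    open ≡.≡-Reasoning
    ⊤? : Decidable (λ (_ : ℕ) → ⊤)
    ⊤? _ = yes tt


-- Gehms up to the values of g off the vertices

infix 4 _≅_

-- g is compared on the vertices only: splicing in different orders yields g's that differ elsewhere.
record _≅_ (G G′ : RawGehm) : Set where
  field
    flags≡ : flags G ≡ flags G′
    b≡     : b G ≡ b G′
    r≡     : r G ≡ r G′
    g≗     : AgreeOn (flags G) (g G) (g G′)
    iso≡   : iso G ≡ iso G′

≅-refl : ∀ {G} → G ≅ G
≅-refl = record { flags≡ = refl ; b≡ = refl ; r≡ = refl ; g≗ = λ _ → refl ; iso≡ = refl }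

≅-sym : ∀ {G G′} → G ≅ G′ → G′ ≅ G
≅-sym G≅G′ = record
  { flags≡ = sym flags≡
  ; b≡     = sym b≡
  ; r≡     = sym r≡
  ; g≗     = λ m → sym (g≗ (subst (_ ∈_) (sym flags≡) m))
  ; iso≡   = sym iso≡
  }
  where open _≅_ G≅G′

≅-trans : ∀ {G₁ G₂ G₃} → G₁ ≅ G₂ → G₂ ≅ G₃ → G₁ ≅ G₃
≅-trans G₁≅G₂ G₂≅G₃ = record
  { flags≡ = trans (flags≡ G₁≅G₂) (flags≡ G₂≅G₃)
  ; b≡     = trans (b≡ G₁≅G₂) (b≡ G₂≅G₃)
  ; r≡     = trans (r≡ G₁≅G₂) (r≡ G₂≅G₃)
  ; g≗     = λ m → trans (g≗ G₁≅G₂ m) (g≗ G₂≅G₃ (subst (_ ∈_) (flags≡ G₁≅G₂) m))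
  ; iso≡   = trans (iso≡ G₁≅G₂) (iso≡ G₂≅G₃)
  }
  where open _≅_

≅-reflexive : ∀ {G G′} → G ≡ G′ → G ≅ G′
≅-reflexive refl = ≅-refl

countCycles-cong : ∀ G G′ {cs cs′} → flags G ≡ flags G′ → Pointwise (AgreeOn (flags G)) cs cs′ →
                   Closed cs (flags G) → countCycles G cs ≡ countCycles G′ cs′
countCycles-cong G G′ {cs} {cs′} flags≡ cs≗ closed =
  trans (length-filter-cong-∈ _ _ (flags G) (λ x m → subst (IsMin x) (orbit≡ m))
                                            (λ x m → subst (IsMin x) (sym (orbit≡ m))))
        (cong (λ F → length (filter (λ x → isMin? x (closeK (length F) cs′ (x ∷ []))) F)) flags≡)
  where
  orbit≡ : ∀ {x} → x ∈ flags G → orbit G cs x ≡ closeK (length (flags G)) cs′ (x ∷ [])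
  orbit≡ {x} x∈ = closeK-cong cs≗ closed (length (flags G)) (x ∷ []) λ { (here refl) → x∈ }

module _ {G G′ : RawGehm} (pg : IsPregehm G) (G≅G′ : G ≅ G′) where
  open IsPregehm pg
  open _≅_ G≅G′

  private
    b≗ : AgreeOn (flags G) (b G) (b G′)
    b≗ {x} _ = cong (λ f → f x) b≡
    r≗ : AgreeOn (flags G) (r G) (r G′)
    r≗ {x} _ = cong (λ f → f x) r≡

  hyperedges-≅ : hyperedges G ≡ hyperedges G′
  hyperedges-≅ rewrite flags≡ | b≡ | r≡ = refl

  vH-≅ : vH G ≡ vH G′
  vH-≅ = cong₂ ℕ._+_ (countCycles-cong G G′ flags≡ (g≗ ∷ r≗ ∷ [])
                                         (involutions-closed (g-inv ∷ r-inv ∷ []))) iso≡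

  fH-≅ : fH G ≡ fH G′
  fH-≅ = cong₂ ℕ._+_ (countCycles-cong G G′ flags≡ (b≗ ∷ g≗ ∷ [])
                                         (involutions-closed (b-inv ∷ g-inv ∷ []))) iso≡

  kH-≅ : kH G ≡ kH G′
  kH-≅ = cong₂ ℕ._+_ (countCycles-cong G G′ flags≡ (b≗ ∷ g≗ ∷ r≗ ∷ [])
                                         (involutions-closed (b-inv ∷ g-inv ∷ r-inv ∷ []))) iso≡

  ρ2-≅ : ρ2 G ≡ ρ2 G′
  ρ2-≅ rewrite vH-≅ | fH-≅ | kH-≅ | hyperedges-≅ = refl

spliceWalk-cong : ∀ {V} U {g g′ c c′} → AgreeOn V g g′ → AgreeOn V c c′ →
                  (∀ {x} → x ∈ V → g x ∈ V) → (∀ {x} → x ∈ V → c x ∈ V) →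
                  ∀ k {y} → y ∈ V → spliceWalk k U g c y ≡ spliceWalk k U g′ c′ y
spliceWalk-cong U g≗ c≗ g∈ c∈ zero y∈V = refl
spliceWalk-cong U {g} {g′} {c} {c′} g≗ c≗ g∈ c∈ (suc k) {y} y∈V with does (y ∈? U)
... | false = refl
... | true  = trans (spliceWalk-cong U g≗ c≗ g∈ c∈ k (g∈ (c∈ y∈V)))
                    (cong (spliceWalk k U g′ c′) (trans (g≗ (c∈ y∈V)) (cong g′ (c≗ y∈V))))

spliceWalk-∼ : ∀ {U U′} g {c c′} → U ∼[ set ] U′ → AgreeOn U c c′ →
               ∀ k y → spliceWalk k U g c y ≡ spliceWalk k U′ g c′ y
spliceWalk-∼ g U∼U′ c≗ zero y = refl
spliceWalk-∼ {U} {U′} g {c} U∼U′ c≗ (suc k) y with y ∈? U | y ∈? U′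
... | yes y∈U | yes _     = trans (cong (λ z → spliceWalk k U g c (g z)) (c≗ y∈U)) (spliceWalk-∼ g U∼U′ c≗ k _)
... | yes y∈U | no y∉U′   = ⊥-elim (y∉U′ (to U∼U′ y∈U))
... | no y∉U  | yes y∈U′  = ⊥-elim (y∉U (from U∼U′ y∈U′))
... | no _    | no _      = refl

splice-≅ : ∀ {G G′} → IsPregehm G → G ≅ G′ → ∀ {c c′} → AgreeOn (flags G) c c′ → InvolutionOn (flags G) c →
           ∀ {U} → (∀ {y} → y ∈ U → y ∈ flags G) → splice G c U ≅ splice G′ c′ U
splice-≅ {G} {G′} pg G≅G′ {c} {c′} c≗ c-inv {U} U⊆ = record
  { flags≡ = cong (filter (_∉? U)) flags≡
  ; b≡ = b≡
  ; r≡ = r≡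
  ; g≗ = λ m → let x∈ = proj₁ (∈ₚ.∈-filter⁻ (_∉? U) {xs = flags G} m) in
         trans (spliceWalk-cong U g≗ c≗ (proj₁ ∘ g-inv) (proj₁ ∘ c-inv) (length (flags G)) (proj₁ (g-inv x∈)))
               (cong₂ (λ k z → spliceWalk k U (g G′) c′ z) (cong length flags≡) (g≗ x∈))
  ; iso≡ = cong₂ ℕ._+_ iso≡
      (trans (length-filter-cong-∈ _ _ U (λ x m → subst (IsRep′ x) (orbit≡ m))
                                         (λ x m → subst (IsRep′ x) (sym (orbit≡ m))))
             (cong (λ F → length (filter (λ x → isRep? (gc′-orbit F) (_∈? U) x) U)) flags≡))
  }
  where
  open IsPregehm pg
  open _≅_ G≅G′
  IsRep′ : ℕ → List ℕ → Set
  IsRep′ x L = IsMin x L × All (_∈ U) L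
  gc′-orbit : List ℕ → ℕ → List ℕ
  gc′-orbit F x = closeK (length F) (g G′ ∷ c′ ∷ []) (x ∷ [])
  orbit≡ : ∀ {x} → x ∈ U → orbit G (g G ∷ c ∷ []) x ≡ gc′-orbit (flags G) x
  orbit≡ {x} x∈U = closeK-cong (g≗ ∷ c≗ ∷ []) (involutions-closed (g-inv ∷ c-inv ∷ []))
                                (length (flags G)) (x ∷ []) λ { (here refl) → U⊆ x∈U }

module _ (G : RawGehm) (pg : IsPregehm G) {U : List ℕ} (U⊆ : ∀ {y} → y ∈ U → y ∈ flags G) where
  open IsPregehm pg

  private
    inside-transfer : ∀ {σ σ′} → InvolutionOn (flags G) σ → InvolutionOn (flags G) σ′ → AgreeOn U σ σ′ →
                      ∀ x → x ∈ U → IsRep (orbit G (g G ∷ σ ∷ [])) (_∈ U) x →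
                      IsRep (orbit G (g G ∷ σ′ ∷ [])) (_∈ U) x
    inside-transfer {σ} {σ′} σ-inv σ′-inv σ≗ x x∈U (x-min , all∈U) = transport x-min , transport all∈U
      where
      module O  = Orbits (flags G) unique (g G ∷ σ ∷ []) (g-inv ∷ σ-inv ∷ [])
      module O′ = Orbits (flags G) unique (g G ∷ σ′ ∷ []) (g-inv ∷ σ′-inv ∷ [])
      inU : ∀ {w} → Reach (g G ∷ σ ∷ []) x w → w ∈ U
      inU r = All.lookup all∈U (O.Reach⇒∈-orbit (U⊆ x∈U) r)
      transfer : ∀ {z y} → (∀ {w} → Reach (g G ∷ σ ∷ []) z w → w ∈ U) →
                 Reach (g G ∷ σ′ ∷ []) z y → Reach (g G ∷ σ ∷ []) z y
      transfer inU′ ε = ε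
      transfer inU′ (here refl ◅ r) = here refl ◅ transfer (λ r′ → inU′ (here refl ◅ r′)) r
      transfer inU′ (there (here refl) ◅ r) = s ◅ transfer (λ r′ → inU′ (s ◅ r′)) r
        where s = there (here (sym (σ≗ (inU′ ε))))
      transport : ∀ {P : ℕ → Set} → All P (O.orbitOf x) → All P (O′.orbitOf x)
      transport all = All.tabulate λ m →
        All.lookup all (O.Reach⇒∈-orbit (U⊆ x∈U) (transfer inU (O′.∈-orbit⇒Reach m)))

  insideCycles-cong : ∀ {σ σ′} → InvolutionOn (flags G) σ → InvolutionOn (flags G) σ′ → AgreeOn U σ σ′ →
                      insideCycles G σ U ≡ insideCycles G σ′ U
  insideCycles-cong σ-inv σ′-inv σ≗ =
    length-filter-cong-∈ _ _ U (inside-transfer σ-inv σ′-inv σ≗) (inside-transfer σ′-inv σ-inv (sym ∘ σ≗))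

insideCycles-∼ : ∀ G σ {U U′} → Unique U → Unique U′ → U ∼[ set ] U′ →
                 insideCycles G σ U ≡ insideCycles G σ U′
insideCycles-∼ G σ {U} {U′} uU uU′ U∼U′ =
  trans (length-filter-cong-∈ _ _ U (λ _ _ (x-min , all) → x-min , All.map (to U∼U′) all)
                                    (λ _ _ (x-min , all) → x-min , All.map (from U∼U′) all))
        (length-filter-∼set _ uU uU′ U∼U′)

splice-cong : ∀ G → IsPregehm G → ∀ {U U′} → Unique U → Unique U′ → U ∼[ set ] U′ →
              (∀ {y} → y ∈ U → y ∈ flags G) →
              ∀ {σ σ′} → InvolutionOn (flags G) σ → InvolutionOn (flags G) σ′ → AgreeOn U σ σ′ →
              splice G σ U ≅ splice G σ′ U′
splice-cong G pg {U} {U′} uU uU′ U∼U′ U⊆ {σ} {σ′} σ-inv σ′-inv σ≗ = record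
  { flags≡ = filter-cong-∈ _ _ (flags G) (λ _ _ x∉U x∈U′ → x∉U (from U∼U′ x∈U′))
                                         (λ _ _ x∉U′ x∈U → x∉U′ (to U∼U′ x∈U))
  ; b≡     = refl
  ; r≡     = refl
  ; g≗     = λ _ → spliceWalk-∼ (g G) U∼U′ σ≗ (length (flags G)) _
  ; iso≡   = cong (iso G ℕ.+_) (trans (insideCycles-cong G pg U⊆ σ-inv σ′-inv σ≗)
                                      (insideCycles-∼ G σ′ uU uU′ U∼U′))
  }


-- Splices along distinct hyperedges commute

module SpliceTwice (G : RawGehm) (pg : IsPregehm G) {e₁ e₂ : Hyperedge}
                   (e₁∈ : e₁ ∈ hyperedges G) (e₂∈ : e₂ ∈ hyperedges G) (e₁≢e₂ : e₁ ≢ e₂)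
                   (c₁ c₂ : ℕ → ℕ)
                   (c₁-inv : InvolutionOn (flags G) c₁) (c₁-E : PreservesHyperedges G c₁)
                   (c₂-inv : InvolutionOn (flags G) c₂) (c₂-E : PreservesHyperedges G c₂) where
  open IsPregehm pg
  open Hyperedges G pg using (F; hyperedges-disjoint)
  module E₁ = Hyperedges.Edge G pg e₁∈
  module E₂ = Hyperedges.Edge G pg e₂∈
  module S₁ = SpliceAlong G pg e₁∈ c₁ c₁-inv (c₁-E e₁∈)

  G₁ : RawGehm
  G₁ = splice G c₁ e₁

  e₂∈G₁ : e₂ ∈ hyperedges G₁
  e₂∈G₁ = ∈-hyperedges-splice G pg c₁ e₁∈ e₂∈ (e₁≢e₂ ∘ sym)

  disjoint : ∀ {y} → ¬ (y ∈ e₁ × y ∈ e₂)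
  disjoint = hyperedges-disjoint e₁∈ e₂∈ e₁≢e₂

  module S₂ = SpliceAlong G₁ S₁.splice-isPregehm e₂∈G₁ c₂ (E₁.rest-inv c₂-inv (c₂-E e₁∈)) (c₂-E e₂∈)

  U : List ℕ
  U = e₁ ++ e₂

  σ : ℕ → ℕ
  σ x = if does (x ∈? e₁) then c₁ x else c₂ x

  σ-e₁ : ∀ {x} → x ∈ e₁ → σ x ≡ c₁ x
  σ-e₁ {x} x∈e₁ with x ∈? e₁
  ... | yes _    = refl
  ... | no x∉e₁  = ⊥-elim (x∉e₁ x∈e₁)

  σ-out : ∀ {x} → x ∉ e₁ → σ x ≡ c₂ x
  σ-out {x} x∉e₁ with x ∈? e₁
  ... | yes x∈e₁ = ⊥-elim (x∉e₁ x∈e₁)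
  ... | no _     = refl

  c₂-out : ∀ {x} → x ∈ F → x ∉ e₁ → c₂ x ∉ e₁
  c₂-out x∈F x∉e₁ c₂x∈e₁ = x∉e₁ (subst (_∈ e₁) (proj₂ (c₂-inv x∈F)) (c₂-E e₁∈ c₂x∈e₁))

  σ-inv : InvolutionOn F σ
  σ-inv {x} x∈F with x ∈? e₁
  ... | yes x∈e₁ = proj₁ (c₁-inv x∈F) , trans (σ-e₁ (c₁-E e₁∈ x∈e₁)) (proj₂ (c₁-inv x∈F))
  ... | no x∉e₁  = proj₁ (c₂-inv x∈F) , trans (σ-out (c₂-out x∈F x∉e₁)) (proj₂ (c₂-inv x∈F))

  ∉U : ∀ {x} → x ∉ e₁ → x ∉ e₂ → x ∉ U
  ∉U x∉e₁ x∉e₂ x∈U = [ x∉e₁ , x∉e₂ ]′ (∈ₚ.∈-++⁻ e₁ x∈U)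

  σ-U : ∀ {x} → x ∈ F → x ∈ U → σ x ∈ U
  σ-U x∈F x∈U with ∈ₚ.∈-++⁻ e₁ x∈U
  ... | inj₁ x∈e₁ = ∈ₚ.∈-++⁺ˡ (subst (_∈ e₁) (sym (σ-e₁ x∈e₁)) (c₁-E e₁∈ x∈e₁))
  ... | inj₂ x∈e₂ = ∈ₚ.∈-++⁺ʳ e₁ (subst (_∈ e₂) (sym (σ-out x∉e₁)) (c₂-E e₂∈ x∈e₂))
    where x∉e₁ = λ x∈e₁ → disjoint (x∈e₁ , x∈e₂)

  U-unique : Unique U
  U-unique = Uniqueₚ.++⁺ E₁.e-unique E₂.e-unique disjoint

  U⊆F : ∀ {y} → y ∈ U → y ∈ F
  U⊆F y∈U = [ E₁.e⊆F , E₂.e⊆F ]′ (∈ₚ.∈-++⁻ e₁ y∈U)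

  module S = Splice F unique U (g G) σ g-inv σ-inv σ-U

  -- In G₁ a hop through e₂ ends in a g-edge of G₁, which is itself a walk through e₁ in G.
  compose-exits : ∀ {m n y y′ w} → S₂.S.Exit m y′ w → S₁.S.Exit n y y′ → y ∈ F → S.Exits y w
  compose-exits {y = y} x₂ (S₁.S.hopin y∈e₁ x₁) y∈F =
    let (k , x) = compose-exits x₂ x₁ (proj₁ (g-inv (proj₁ (c₁-inv y∈F)))) in
    suc k , S.hopin (∈ₚ.∈-++⁺ˡ y∈e₁) (subst (λ z → S.Exit k (g G z) _) (sym (σ-e₁ y∈e₁)) x)
  compose-exits (S₂.S.leave y∉e₂) (S₁.S.leave y∉e₁) y∈F = 0 , S.leave (∉U y∉e₁ y∉e₂)
  compose-exits {y = y} (S₂.S.hopin y∈e₂ x₂) (S₁.S.leave y∉e₁) y∈F =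
    let c₂y∈F = proj₁ (c₂-inv y∈F)
        (_ , x₁) = S₁.S.exit-ĝ c₂y∈F (c₂-out y∈F y∉e₁)
        (k , x) = compose-exits x₂ x₁ (proj₁ (g-inv c₂y∈F)) in
    suc k , S.hopin (∈ₚ.∈-++⁺ʳ e₁ y∈e₂) (subst (λ z → S.Exit k (g G z) _) (sym (σ-out y∉e₁)) x)

  flags-splice-splice : flags (splice G₁ c₂ e₂) ≡ flags (splice G σ U)
  flags-splice-splice = trans (filter-filter (_∉? e₂) (_∉? e₁) F)
    (filter-cong-∈ _ (_∉? U) F (λ _ _ (x∉e₂ , x∉e₁) → ∉U x∉e₁ x∉e₂)
                                (λ _ _ x∉U → (x∉U ∘ ∈ₚ.∈-++⁺ʳ e₁) , (x∉U ∘ ∈ₚ.∈-++⁺ˡ)))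

  g-splice-splice : AgreeOn (flags (splice G₁ c₂ e₂)) (g (splice G₁ c₂ e₂)) (g (splice G σ U))
  g-splice-splice {x} m =
    let (x∈rest₁ , x∉e₂) = ∈ₚ.∈-filter⁻ (_∉? e₂) {xs = E₁.rest} m
        (x∈F , x∉e₁) = E₁.∈rest⁻ x∈rest₁
        (_ , x₁) = S₁.S.exit-ĝ x∈F x∉e₁
        (_ , x₂) = S₂.S.exit-ĝ x∈rest₁ x∉e₂
        (_ , x) = compose-exits x₂ x₁ (proj₁ (g-inv x∈F))
    in S.Exit-functional x (proj₂ (S.exit-ĝ x∈F (∉U x∉e₁ x∉e₂)))

  module Oσ = Orbits F unique (g G ∷ σ ∷ []) (g-inv ∷ σ-inv ∷ [])
  module R = S₁.S.Reachability σ c₂ (λ _ → σ-e₁) (λ _ → σ-out)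
                               (λ z∈F z∉e₁ → proj₁ (c₂-inv z∈F) , c₂-out z∈F z∉e₁)

  orbit-splice : ∀ {x} → x ∈ F → x ∉ e₁ → S₂.O.orbitOf x ∼[ set ] filter (_∉? e₁) (Oσ.orbitOf x)
  orbit-splice x∈F x∉e₁ = mk⇔
    (λ m → ∈ₚ.∈-filter⁺ (_∉? e₁) (Oσ.Reach⇒∈-orbit x∈F (R.spliced⇒Reach out (S₂.O.∈-orbit⇒Reach m)))
                                 (proj₂ (E₁.∈rest⁻ (S₂.O.orbit-⊆ (E₁.∈rest⁺ x∈F x∉e₁) m))))
    (λ m → let (m′ , y∉e₁) = ∈ₚ.∈-filter⁻ (_∉? e₁) {xs = Oσ.orbitOf _} m in
           S₂.O.Reach⇒∈-orbit (E₁.∈rest⁺ x∈F x∉e₁)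
                              (R.Reach⇒spliced out y∉e₁ (Oσ.∈-orbit⇒Reach m′)))
    where out = x∈F , x∉e₁

  insideCycles-splice-splice : insideCycles G σ U ≡ insideCycles G₁ c₂ e₂ ℕ.+ insideCycles G c₁ e₁
  insideCycles-splice-splice = begin
    classCount Oσ.orbitOf (_∈? U) U
      ≡⟨ length-filter-⊆ (isRep? Oσ.orbitOf (_∈? U)) F U unique U-unique U⊆F
                         (λ x x∈F (_ , all∈U) → All.lookup all∈U (Oσ.orbit-self x∈F)) ⟨
    classCount Oσ.orbitOf (_∈? U) F
      ≡⟨ ClassCount.classCount-split (_∉? e₁) (_∈? U) unique (orbits-isClassMap F unique _ (g-inv ∷ σ-inv ∷ []))
           orbit-splice (λ _ ¬x∉e₁ → ∈ₚ.∈-++⁺ˡ (decidable-stable (_ ∈? e₁) ¬x∉e₁)) ⟩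
    classCount S₂.O.orbitOf (_∈? U) E₁.rest ℕ.+
    classCount Oσ.orbitOf (λ y → ¬? (y ∉? e₁)) (filter (λ y → ¬? (y ∉? e₁)) F)
      ≡⟨ cong₂ ℕ._+_ inside-e₂ (trans (classCount-inside F e₁ Oσ.orbitOf unique E₁.e-unique E₁.e⊆F)
                                      (insideCycles-cong G pg E₁.e⊆F σ-inv c₁-inv σ-e₁)) ⟩
    insideCycles G₁ c₂ e₂ ℕ.+ insideCycles G c₁ e₁
      ∎
    where
    open ≡.≡-Reasoning
    e₂⊆rest₁ : ∀ {y} → y ∈ e₂ → y ∈ E₁.rest
    e₂⊆rest₁ y∈e₂ = E₁.∈rest⁺ (E₂.e⊆F y∈e₂) (λ y∈e₁ → disjoint (y∈e₁ , y∈e₂))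
    inside-e₂ : classCount S₂.O.orbitOf (_∈? U) E₁.rest ≡ insideCycles G₁ c₂ e₂
    inside-e₂ = begin
      classCount S₂.O.orbitOf (_∈? U) E₁.rest
        ≡⟨ length-filter-cong-∈ _ (isRep? S₂.O.orbitOf (_∈? e₂)) E₁.rest
             (λ x m (x-min , all∈U) → x-min , All.tabulate (λ {y} y∈ →
                 [ ⊥-elim ∘ proj₂ (E₁.∈rest⁻ (S₂.O.orbit-⊆ m y∈)) , (λ y∈e₂ → y∈e₂) ]′
                 (∈ₚ.∈-++⁻ e₁ (All.lookup all∈U y∈))))
             (λ x m (x-min , all∈e₂) → x-min , All.map (∈ₚ.∈-++⁺ʳ e₁) all∈e₂) ⟩
      classCount S₂.O.orbitOf (_∈? e₂) E₁.rest
        ≡⟨ length-filter-⊆ _ E₁.rest e₂ E₁.rest-unique E₂.e-unique e₂⊆rest₁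
                           (λ x x∈ (_ , all∈e₂) → All.lookup all∈e₂ (S₂.O.orbit-self x∈)) ⟩
      insideCycles G₁ c₂ e₂
        ∎

  splice-splice : splice G₁ c₂ e₂ ≅ splice G σ U
  splice-splice = record
    { flags≡ = flags-splice-splice
    ; b≡     = refl
    ; r≡     = refl
    ; g≗     = g-splice-splice
    ; iso≡   = begin
        (iso G ℕ.+ i₁) ℕ.+ i₂   ≡⟨ ℕₚ.+-assoc (iso G) i₁ i₂ ⟩
        iso G ℕ.+ (i₁ ℕ.+ i₂)   ≡⟨ cong (iso G ℕ.+_) (ℕₚ.+-comm i₁ i₂) ⟩
        iso G ℕ.+ (i₂ ℕ.+ i₁)   ≡⟨ cong (iso G ℕ.+_) insideCycles-splice-splice ⟨
        iso G ℕ.+ insideCycles G σ U   ∎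
    }
    where
    open ≡.≡-Reasoning
    i₁ = insideCycles G c₁ e₁
    i₂ = insideCycles G₁ c₂ e₂

splice-comm : ∀ G → IsPregehm G → ∀ {e₁ e₂} → e₁ ∈ hyperedges G → e₂ ∈ hyperedges G → e₁ ≢ e₂ →
              ∀ c₁ c₂ → InvolutionOn (flags G) c₁ → PreservesHyperedges G c₁ →
              InvolutionOn (flags G) c₂ → PreservesHyperedges G c₂ →
              splice (splice G c₁ e₁) c₂ e₂ ≅ splice (splice G c₂ e₂) c₁ e₁
splice-comm G pg {e₁} {e₂} e₁∈ e₂∈ e₁≢e₂ c₁ c₂ c₁-inv c₁-E c₂-inv c₂-E =
  ≅-trans A.splice-splice
    (≅-trans (splice-cong G pg A.U-unique B.U-unique (mk⇔ (++-comm e₁ e₂) (++-comm e₂ e₁))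
                          A.U⊆F A.σ-inv B.σ-inv σ≗)
             (≅-sym B.splice-splice))
  where
  module A = SpliceTwice G pg e₁∈ e₂∈ e₁≢e₂ c₁ c₂ c₁-inv c₁-E c₂-inv c₂-E
  module B = SpliceTwice G pg e₂∈ e₁∈ (e₁≢e₂ ∘ sym) c₂ c₁ c₂-inv c₂-E c₁-inv c₁-E
  ++-comm : ∀ xs ys {x} → x ∈ xs ++ ys → x ∈ ys ++ xs
  ++-comm xs ys m = [ ∈ₚ.∈-++⁺ʳ ys , ∈ₚ.∈-++⁺ˡ ]′ (∈ₚ.∈-++⁻ xs m)
  σ≗ : AgreeOn A.U A.σ B.σ
  σ≗ x∈U with ∈ₚ.∈-++⁻ e₁ x∈U
  ... | inj₁ x∈e₁ = trans (A.σ-e₁ x∈e₁) (sym (B.σ-out (λ x∈e₂ → A.disjoint (x∈e₁ , x∈e₂))))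
  ... | inj₂ x∈e₂ = trans (A.σ-out (λ x∈e₁ → A.disjoint (x∈e₁ , x∈e₂))) (sym (B.σ-e₁ x∈e₂))


-- Deletion and contraction of a single hyperedge

data EdgeColour : Set where
  blue red : EdgeColour

colour : EdgeColour → RawGehm → ℕ → ℕ
colour blue = b
colour red  = r

spliceᶜ : EdgeColour → RawGehm → Hyperedge → RawGehm
spliceᶜ κ G e = splice G (colour κ G) e

colour-splice : ∀ κ G c e → colour κ (splice G c e) ≡ colour κ G
colour-splice blue G c e = refl
colour-splice red  G c e = refl

module _ {G : RawGehm} (pg : IsPregehm G) where

  colour-inv : ∀ κ → InvolutionOn (flags G) (colour κ G)
  colour-inv blue = IsPregehm.b-inv pg
  colour-inv red  = IsPregehm.r-inv pg

  colour-preserves : ∀ κ → PreservesHyperedges G (colour κ G)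
  colour-preserves blue = b-preserves G pg
  colour-preserves red  = r-preserves G pg

  spliceᶜ-isPregehm : ∀ κ {e} → e ∈ hyperedges G → IsPregehm (spliceᶜ κ G e)
  spliceᶜ-isPregehm κ e∈ = SpliceAlong.splice-isPregehm G pg e∈ (colour κ G) (colour-inv κ) (colour-preserves κ e∈)

ρ-form : ℕ → ℕ → ℕ → ℕ → ℤ
ρ-form v e d f = ((+ v -ℤ + e) +ℤ + d) -ℤ + f

-- 2ρ = 2v − 2k + γ, in which k cancels.
ρ2-form : ∀ G → ρ2 G ≡ ρ-form (vH G) (eH G) (dH G) (fH G)
ρ2-form G rewrite ℤₚ.pos-* 2 (vH G) | ℤₚ.pos-* 2 (kH G) =
  solve 5 (λ v k e d f → (con (+ 2) :* v :- con (+ 2) :* k) :+ ((((con (+ 2) :* k :- v) :- e) :+ d) :- f)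
                         := ((v :- e) :+ d) :- f) refl (+ vH G) (+ kH G) (+ eH G) (+ dH G) (+ fH G)
  where open +-*-Solver

ρ-form-deletion : ∀ v e d δ f f′ →
                  ρ-form v (e ℕ.+ 1) (d ℕ.+ δ) f ≡ (((+ f′ -ℤ + f) +ℤ + δ) -ℤ + 1) +ℤ ρ-form v e d f′
ρ-form-deletion v e d δ f f′ rewrite ℤₚ.pos-+ e 1 | ℤₚ.pos-+ d δ =
  solve 6 (λ v e d δ f f′ → ((v :- (e :+ con (+ 1))) :+ (d :+ δ)) :- f
                         := (((f′ :- f) :+ δ) :- con (+ 1)) :+ (((v :- e) :+ d) :- f′))
          refl (+ v) (+ e) (+ d) (+ δ) (+ f) (+ f′)
  where open +-*-Solver

ρ-form-contraction : ∀ v v′ e d δ f →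
                     ρ-form v (e ℕ.+ 1) (d ℕ.+ δ) f ≡ (((+ v -ℤ + v′) +ℤ + δ) -ℤ + 1) +ℤ ρ-form v′ e d f
ρ-form-contraction v v′ e d δ f rewrite ℤₚ.pos-+ e 1 | ℤₚ.pos-+ d δ =
  solve 6 (λ v v′ e d δ f → ((v :- (e :+ con (+ 1))) :+ (d :+ δ)) :- f
                         := (((v :- v′) :+ δ) :- con (+ 1)) :+ (((v′ :- e) :+ d) :- f))
          refl (+ v) (+ v′) (+ e) (+ d) (+ δ) (+ f)
  where open +-*-Solver

countCycles-swap : ∀ {G} → IsPregehm G → ∀ {c₁ c₂} → InvolutionOn (flags G) c₁ → InvolutionOn (flags G) c₂ →
                   countCycles G (c₁ ∷ c₂ ∷ []) ≡ countCycles G (c₂ ∷ c₁ ∷ [])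
countCycles-swap {G} pg {c₁} {c₂} c₁-inv c₂-inv =
  length-filter-cong-∈ _ _ (flags G) (λ _ m → transport (orbit-swap m))
                                     (λ _ m → transport (∼set-sym (orbit-swap m)))
  where
  module O₁₂ = Orbits (flags G) (IsPregehm.unique pg) (c₁ ∷ c₂ ∷ []) (c₁-inv ∷ c₂-inv ∷ [])
  module O₂₁ = Orbits (flags G) (IsPregehm.unique pg) (c₂ ∷ c₁ ∷ []) (c₂-inv ∷ c₁-inv ∷ [])
  swap : ∀ {c c′ y z} → Step (c ∷ c′ ∷ []) y z → Step (c′ ∷ c ∷ []) y z
  swap (here z≡)         = there (here z≡)
  swap (there (here z≡)) = here z≡
  orbit-swap : ∀ {x} → x ∈ flags G → O₁₂.orbitOf x ∼[ set ] O₂₁.orbitOf x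
  orbit-swap x∈ = mk⇔ (λ m → O₂₁.Reach⇒∈-orbit x∈ (Star.map swap (O₁₂.∈-orbit⇒Reach m)))
                      (λ m → O₁₂.Reach⇒∈-orbit x∈ (Star.map swap (O₂₁.∈-orbit⇒Reach m)))
  transport : ∀ {x L L′} → L ∼[ set ] L′ → IsMin x L → IsMin x L′
  transport L∼L′ x-min = All.tabulate λ m → All.lookup x-min (from L∼L′ m)

module _ {G : RawGehm} (pg : IsPregehm G) {e : Hyperedge} (e∈ : e ∈ hyperedges G) where
  open IsPregehm pg

  private
    module S = SpliceAlong G pg e∈
    open Hyperedges.Edge G pg e∈ using (hyperedges-splice)
    rem = removeE e (hyperedges G)
    split : ∃ λ pre → ∃ λ post → hyperedges G ≡ pre ++ e ∷ post
    split = ∈ₚ.∈-∃++ e∈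
    hyperedges-↭ : hyperedges G ↭ e ∷ rem
    hyperedges-↭ = let (pre , post , E≡) = split in
      subst (λ E → E ↭ e ∷ removeE e E) (sym E≡)
        (subst (λ L → pre ++ e ∷ post ↭ e ∷ L)
               (sym (removeE-middle pre post e (subst Unique E≡ (Hyperedges.hyperedges-unique G pg))))
               (↭ₚ.shift e pre post))

  countCycles-iso-splice : ∀ c (c-inv : InvolutionOn (flags G) c) (c-e : ∀ {y} → y ∈ e → c y ∈ e) →
                           countCycles (splice G c e) (g (splice G c e) ∷ c ∷ []) ℕ.+ iso (splice G c e) ≡
                           countCycles G (g G ∷ c ∷ []) ℕ.+ iso G
  countCycles-iso-splice c c-inv c-e =
    trans (x∙yz≈xz∙y (countCycles (splice G c e) _) (iso G) (insideCycles G c e))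
          (cong (ℕ._+ iso G) (sym (S.countCycles-splice c c-inv c-e)))
    where open import Algebra.Properties.CommutativeSemigroup ℕₚ.+-commutativeSemigroup using (x∙yz≈xz∙y)

  vH-∖ₕ : vH (G ∖ₕ e) ≡ vH G
  vH-∖ₕ = countCycles-iso-splice (r G) r-inv (r-preserves G pg e∈)

  fH-/ₕ : fH (G /ₕ e) ≡ fH G
  fH-/ₕ = begin
    countCycles (G /ₕ e) (b G ∷ g (G /ₕ e) ∷ []) ℕ.+ iso (G /ₕ e)
      ≡⟨ cong (ℕ._+ iso (G /ₕ e)) (countCycles-swap pg/ (IsPregehm.b-inv pg/) (IsPregehm.g-inv pg/)) ⟩
    countCycles (G /ₕ e) (g (G /ₕ e) ∷ b G ∷ []) ℕ.+ iso (G /ₕ e)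
      ≡⟨ countCycles-iso-splice (b G) b-inv (b-preserves G pg e∈) ⟩
    countCycles G (g G ∷ b G ∷ []) ℕ.+ iso G
      ≡⟨ cong (ℕ._+ iso G) (countCycles-swap pg g-inv b-inv) ⟩
    countCycles G (b G ∷ g G ∷ []) ℕ.+ iso G
      ∎
    where
    open ≡.≡-Reasoning
    pg/ = spliceᶜ-isPregehm pg blue e∈

  eH-splice : ∀ c → eH (splice G c e) ℕ.+ 1 ≡ eH G
  eH-splice c = begin
    length (hyperedges (splice G c e)) ℕ.+ 1  ≡⟨ cong (λ E → length E ℕ.+ 1) (hyperedges-splice c) ⟩
    length rem ℕ.+ 1                          ≡⟨ ℕₚ.+-comm (length rem) 1 ⟩
    length (e ∷ rem)                          ≡⟨ ↭ₚ.↭-length hyperedges-↭ ⟨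
    length (hyperedges G)                     ∎
    where open ≡.≡-Reasoning

  dH-splice : ∀ c → dH (splice G c e) ℕ.+ dEdge e ≡ dH G
  dH-splice c = begin
    dSet (hyperedges (splice G c e)) ℕ.+ dEdge e  ≡⟨ cong (λ E → dSet E ℕ.+ dEdge e) (hyperedges-splice c) ⟩
    dSet rem ℕ.+ dEdge e                          ≡⟨ ℕₚ.+-comm (dSet rem) (dEdge e) ⟩
    dSet (e ∷ rem)                                ≡⟨ sum-↭ (↭ₚ.map⁺ dEdge hyperedges-↭) ⟨
    dSet (hyperedges G)                           ∎
    where open ≡.≡-Reasoning

  ρ2-∖ₕ : ρ2 G ≡ (((+ fH (G ∖ₕ e) -ℤ + fH G) +ℤ + dEdge e) -ℤ + 1) +ℤ ρ2 (G ∖ₕ e)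
  ρ2-∖ₕ = begin
    ρ2 G
      ≡⟨ ρ2-form G ⟩
    ρ-form (vH G) (eH G) (dH G) (fH G)
      ≡⟨ cong₂ (λ v e → ρ-form v e (dH G) (fH G)) vH-∖ₕ (eH-splice (r G)) ⟨
    ρ-form (vH G′) (eH G′ ℕ.+ 1) (dH G) (fH G)
      ≡⟨ cong (λ d → ρ-form (vH G′) (eH G′ ℕ.+ 1) d (fH G)) (dH-splice (r G)) ⟨
    ρ-form (vH G′) (eH G′ ℕ.+ 1) (dH G′ ℕ.+ dEdge e) (fH G)
      ≡⟨ ρ-form-deletion (vH G′) (eH G′) (dH G′) (dEdge e) (fH G) (fH G′) ⟩
    δ +ℤ ρ-form (vH G′) (eH G′) (dH G′) (fH G′)
      ≡⟨ cong (δ +ℤ_) (ρ2-form G′) ⟨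
    δ +ℤ ρ2 G′
      ∎
    where
    open ≡.≡-Reasoning
    G′ = G ∖ₕ e
    δ = ((+ fH G′ -ℤ + fH G) +ℤ + dEdge e) -ℤ + 1

  ρ2-/ₕ : ρ2 G ≡ (((+ vH G -ℤ + vH (G /ₕ e)) +ℤ + dEdge e) -ℤ + 1) +ℤ ρ2 (G /ₕ e)
  ρ2-/ₕ = begin
    ρ2 G
      ≡⟨ ρ2-form G ⟩
    ρ-form (vH G) (eH G) (dH G) (fH G)
      ≡⟨ cong₂ (λ e d → ρ-form (vH G) e d (fH G)) (eH-splice (b G)) (dH-splice (b G)) ⟨
    ρ-form (vH G) (eH G′ ℕ.+ 1) (dH G′ ℕ.+ dEdge e) (fH G)
      ≡⟨ ρ-form-contraction (vH G) (vH G′) (eH G′) (dH G′) (dEdge e) (fH G) ⟩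
    δ +ℤ ρ-form (vH G′) (eH G′) (dH G′) (fH G)
      ≡⟨ cong (λ f → δ +ℤ ρ-form (vH G′) (eH G′) (dH G′) f) fH-/ₕ ⟨
    δ +ℤ ρ-form (vH G′) (eH G′) (dH G′) (fH G′)
      ≡⟨ cong (δ +ℤ_) (ρ2-form G′) ⟨
    δ +ℤ ρ2 G′
      ∎
    where
    open ≡.≡-Reasoning
    G′ = G /ₕ e
    δ = ((+ vH G -ℤ + vH G′) +ℤ + dEdge e) -ℤ + 1


-- Restriction to a set of hyperedges

Deletable : RawGehm → List Hyperedge → Set
Deletable G N = Unique N × All (_∈ hyperedges G) N

Deletable-⊆ : ∀ {G} → IsPregehm G → ∀ {N} → N ⊆ hyperedges G → Deletable G N
Deletable-⊆ {G} pg N⊆ =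
  Unique-⊆ N⊆ (Hyperedges.hyperedges-unique G pg) , All.tabulate (Sublistₚ.Any-resp-⊆ N⊆)

Deletable-↭ : ∀ {G N N′} → N ↭ N′ → Deletable G N → Deletable G N′
Deletable-↭ N↭N′ (uN , N∈) =
  ↭ₛₚ.Unique-resp-↭ (≡.setoid Hyperedge) (↭⇒↭ₛ N↭N′) uN , ↭ₚ.All-resp-↭ N↭N′ N∈

restrict-isPregehm : ∀ {G} → IsPregehm G → ∀ {N} → Deletable G N → IsPregehm (restrict G N)
∈-hyperedges-restrict : ∀ {G} → IsPregehm G → ∀ {N} → Deletable G N →
                        ∀ {h} → h ∈ hyperedges G → h ∉ N → h ∈ hyperedges (restrict G N)

restrict-isPregehm pg {[]}    _ = pg
restrict-isPregehm pg {n ∷ N} (n∉N ∷ uN , n∈ ∷ N∈) =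
  spliceᶜ-isPregehm (restrict-isPregehm pg (uN , N∈)) red
    (∈-hyperedges-restrict pg (uN , N∈) n∈ (λ m → All.lookup n∉N m refl))

∈-hyperedges-restrict pg {[]}    _ h∈ _ = h∈
∈-hyperedges-restrict {G} pg {n ∷ N} (n∉N ∷ uN , n∈ ∷ N∈) h∈ h∉ =
  ∈-hyperedges-splice _ (restrict-isPregehm pg (uN , N∈)) (r (restrict G N))
    (∈-hyperedges-restrict pg (uN , N∈) n∈ (λ m → All.lookup n∉N m refl))
    (∈-hyperedges-restrict pg (uN , N∈) h∈ (h∉ ∘ there)) (h∉ ∘ here)

colour-restrict : ∀ κ G N → colour κ (restrict G N) ≡ colour κ G
colour-restrict κ G []      = refl
colour-restrict κ G (n ∷ N) = trans (colour-splice κ (restrict G N) _ n) (colour-restrict κ G N)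

restrict-≅ : ∀ {X Y} → IsPregehm X → X ≅ Y → ∀ {N} → Deletable X N → restrict X N ≅ restrict Y N
restrict-≅ pg X≅Y {[]}    _ = X≅Y
restrict-≅ {X} {Y} pg X≅Y {n ∷ N} (n∉N ∷ uN , n∈ ∷ N∈) =
  splice-≅ pgN (restrict-≅ pg X≅Y (uN , N∈)) r≗ (IsPregehm.r-inv pgN)
    (Hyperedges.Edge.e⊆F _ pgN (∈-hyperedges-restrict pg (uN , N∈) n∈ (λ m → All.lookup n∉N m refl)))
  where
  pgN = restrict-isPregehm pg (uN , N∈)
  r≗ : AgreeOn (flags (restrict X N)) (r (restrict X N)) (r (restrict Y N))
  r≗ {x} _ = cong (λ f → f x) (trans (colour-restrict red X N) (trans (_≅_.r≡ X≅Y) (sym (colour-restrict red Y N))))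

restrict-spliceᶜ : ∀ κ {H} → IsPregehm H → ∀ {e N} → Deletable H (e ∷ N) →
                   spliceᶜ κ (restrict H N) e ≅ restrict (spliceᶜ κ H e) N
restrict-spliceᶜ κ pg {e} {[]}     _ = ≅-refl
restrict-spliceᶜ κ {H} pg {e} {e′ ∷ N} ((e∉ ∷ e′∉N ∷ uN) , (e∈ ∷ e′∈ ∷ N∈)) =
  ≅-trans (≅-reflexive (cong (λ c → splice (X ∖ₕ e′) c e) (colour-splice κ X (r X) e′)))
  (≅-trans (splice-comm X pgX e′∈X e∈X e′≢e (r X) (colour κ X) (colour-inv pgX red) (colour-preserves pgX red)
                                                                  (colour-inv pgX κ) (colour-preserves pgX κ))
           (splice-≅ pgXᶜ (restrict-spliceᶜ κ pg (All.tail e∉ ∷ uN , e∈ ∷ N∈)) r≗ (IsPregehm.r-inv pgXᶜ)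
                     (Hyperedges.Edge.e⊆F _ pgXᶜ (∈-hyperedges-splice X pgX (colour κ X) e∈X e′∈X e′≢e))))
  where
  X = restrict H N
  pgX = restrict-isPregehm pg (uN , N∈)
  e∈X = ∈-hyperedges-restrict pg (uN , N∈) e∈ (λ m → All.lookup e∉ (there m) refl)
  e′∈X = ∈-hyperedges-restrict pg (uN , N∈) e′∈ (λ m → All.lookup e′∉N m refl)
  e′≢e : e′ ≢ e
  e′≢e e′≡e = All.lookup e∉ (here (sym e′≡e)) refl
  pgXᶜ = spliceᶜ-isPregehm pgX κ e∈X
  r≗ : AgreeOn (flags (spliceᶜ κ X e)) (r X) (r (restrict (spliceᶜ κ H e) N))
  r≗ {x} _ = cong (λ f → f x) (trans (colour-restrict red H N) (sym (colour-restrict red (spliceᶜ κ H e) N)))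

restrict-∖ₕ : ∀ {H} → IsPregehm H → ∀ N₁ e N₂ → Deletable H (N₁ ++ e ∷ N₂) →
              restrict H (N₁ ++ e ∷ N₂) ≅ restrict (H ∖ₕ e) (N₁ ++ N₂)
restrict-∖ₕ {H} pg N₁ e N₂ (uN , N∈) =
  subst₂ _≅_ (sym (Listₚ.foldr-++ (λ e G → G ∖ₕ e) H N₁ (e ∷ N₂)))
             (sym (Listₚ.foldr-++ (λ e G → G ∖ₕ e) (H ∖ₕ e) N₁ N₂))
             (restrict-≅ (restrict-isPregehm pg del₂) (restrict-spliceᶜ red pg del₂) del₁)
  where
  u₁ : Unique N₁
  u₁ = Unique-⊆ (Sublistₚ.++⁺ʳ (e ∷ N₂) ⊆-refl) uN
  del₂ : Deletable H (e ∷ N₂)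
  del₂ = Unique-⊆ (Sublistₚ.++⁺ˡ N₁ ⊆-refl) uN , Allₚ.++⁻ʳ N₁ N∈
  disjoint : ∀ {n} → n ∈ N₁ → n ∉ e ∷ N₂
  disjoint {n} n∈N₁ n∈ = go N₁ uN n∈N₁
    where
    go : ∀ ys → Unique (ys ++ e ∷ N₂) → n ∈ ys → ⊥
    go (y ∷ ys) (y∉ ∷ u) (here refl) = All.lookup (Allₚ.++⁻ʳ ys y∉) n∈ refl
    go (y ∷ ys) (y∉ ∷ u) (there m)   = go ys u m
  del₁ : Deletable (restrict H (e ∷ N₂)) N₁
  del₁ = u₁ , All.tabulate (λ m → ∈-hyperedges-restrict pg del₂ (All.lookup (Allₚ.++⁻ˡ N₁ N∈) m) (disjoint m))

vH-restrict : ∀ {G} → IsPregehm G → ∀ {N} → Deletable G N → vH (restrict G N) ≡ vH G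
vH-restrict pg {[]}    _ = refl
vH-restrict pg {n ∷ N} (n∉N ∷ uN , n∈ ∷ N∈) =
  trans (vH-∖ₕ (restrict-isPregehm pg (uN , N∈))
               (∈-hyperedges-restrict pg (uN , N∈) n∈ (λ m → All.lookup n∉N m refl)))
        (vH-restrict pg (uN , N∈))

hyperedges≡[]⇒flags≡[] : ∀ {G} → IsPregehm G → hyperedges G ≡ [] → flags G ≡ []
hyperedges≡[]⇒flags≡[] {G} pg E≡[] =
  no-members λ {x} x∈F → ∉[] (subst (orbitOf (minimum (orbitOf x)) ∈_) E≡[] (rep-orbit∈ x∈F))
  where
  open Hyperedges G pg
  rep-orbit∈ : ∀ {x} → x ∈ F → orbitOf (minimum (orbitOf x)) ∈ hyperedges G
  rep-orbit∈ {x} x∈F = ∈ₚ.∈-map⁺ orbitOf (∈ₚ.∈-filter⁺ isRep-br? (orbit-⊆ x∈F m∈) m-min)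
    where
    m∈ = minimum-∈ (orbitOf x) (orbit-self x∈F)
    m-min : IsMin (minimum (orbitOf x)) (orbitOf (minimum (orbitOf x)))
    m-min = All.tabulate λ y∈ → minimum-≤ (orbitOf x) (to (orbit-∼ x∈F m∈) y∈)
  ∉[] : ∀ {h : Hyperedge} → h ∉ []
  ∉[] ()
  no-members : ∀ {xs : List ℕ} → (∀ {x} → x ∉ xs) → xs ≡ []
  no-members {[]}    _    = refl
  no-members {x ∷ _} none = ⊥-elim (none (here refl))

ρ2-no-hyperedges : ∀ {G} → IsPregehm G → hyperedges G ≡ [] → ρ2 G ≡ + 0
ρ2-no-hyperedges {G} pg E≡[] = begin
  ρ2 G
    ≡⟨ ρ2-form G ⟩
  ρ-form (vH G) (eH G) (dH G) (fH G)
    ≡⟨ cong₂ (λ v f → ρ-form v (eH G) (dH G) f) (cycles-vanish (g G ∷ r G ∷ []))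
                                                 (cycles-vanish (b G ∷ g G ∷ [])) ⟩
  ρ-form (iso G) (eH G) (dH G) (iso G)
    ≡⟨ cong₂ (λ e d → ρ-form (iso G) e d (iso G)) (cong length E≡[]) (cong dSet E≡[]) ⟩
  ρ-form (iso G) 0 0 (iso G)
    ≡⟨ solve 1 (λ i → ((i :- con (+ 0)) :+ con (+ 0)) :- i := con (+ 0)) refl (+ iso G) ⟩
  + 0
    ∎
  where
  open ≡.≡-Reasoning
  open +-*-Solver
  cycles-vanish : ∀ cs → countCycles G cs ℕ.+ iso G ≡ iso G
  cycles-vanish cs =
    cong (λ F → length (filter (λ x → isMin? x (orbit G cs x)) F) ℕ.+ iso G) (hyperedges≡[]⇒flags≡[] pg E≡[])


-- Sums over splits

Split : Set
Split = List Hyperedge × List Hyperedge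

merge : Split → Split → Split
merge (A₁ , N₁) (A₂ , N₂) = A₁ ++ A₂ , N₁ ++ N₂

splits-⊆ : ∀ {X : Set} (xs : List X) {s} → s ∈ splits xs → proj₁ s ⊆ xs × proj₂ s ⊆ xs
splits-⊆ []       (here refl) = [] , []
splits-⊆ (x ∷ xs) m with ∈ₚ.∈-++⁻ (map (λ s → x ∷ proj₁ s , proj₂ s) (splits xs)) m
... | inj₁ m₁ with ∈ₚ.∈-map⁻ (λ (s : List _ × List _) → x ∷ proj₁ s , proj₂ s) m₁
...   | (s , s∈ , refl) = refl ∷ proj₁ (splits-⊆ xs s∈) , x ∷ʳ proj₂ (splits-⊆ xs s∈)
splits-⊆ (x ∷ xs) m | inj₂ m₂ with ∈ₚ.∈-map⁻ (λ (s : List _ × List _) → proj₁ s , x ∷ proj₂ s) m₂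
...   | (s , s∈ , refl) = x ∷ʳ proj₁ (splits-⊆ xs s∈) , refl ∷ proj₂ (splits-⊆ xs s∈)

module SplitSums {c ℓ} (R : CommutativeRing c ℓ) where
  open CommutativeRing R renaming (refl to ≈-refl; sym to ≈-sym; trans to ≈-trans)
  open TuttePoly R
  open import Relation.Binary.Reasoning.Setoid setoid
  open import Algebra.Properties.CommutativeSemigroup +-commutativeSemigroup using (interchange)

  sumR-++ : ∀ {X : Set} (f : X → Carrier) xs ys →
            sumR (map f (xs ++ ys)) ≈ sumR (map f xs) + sumR (map f ys)
  sumR-++ f []       ys = ≈-sym (+-identityˡ _)
  sumR-++ f (x ∷ xs) ys = ≈-trans (+-cong ≈-refl (sumR-++ f xs ys)) (≈-sym (+-assoc _ _ _))

  sumR-cong : ∀ {X : Set} {f h : X → Carrier} xs → (∀ {x} → x ∈ xs → f x ≈ h x) →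
              sumR (map f xs) ≈ sumR (map h xs)
  sumR-cong []       f≈h = ≈-refl
  sumR-cong (x ∷ xs) f≈h = +-cong (f≈h (here refl)) (sumR-cong xs (f≈h ∘ there))

  sumR-+ : ∀ {X : Set} (f h : X → Carrier) xs →
           sumR (map (λ x → f x + h x) xs) ≈ sumR (map f xs) + sumR (map h xs)
  sumR-+ f h []       = ≈-sym (+-identityˡ _)
  sumR-+ f h (x ∷ xs) = ≈-trans (+-cong ≈-refl (sumR-+ f h xs)) (interchange _ _ _ _)

  sumR-* : ∀ {X : Set} (k : Carrier) (f : X → Carrier) xs →
           sumR (map (λ x → k * f x) xs) ≈ k * sumR (map f xs)
  sumR-* k f []       = ≈-sym (zeroʳ k)
  sumR-* k f (x ∷ xs) = ≈-trans (+-cong ≈-refl (sumR-* k f xs)) (≈-sym (distribˡ _ _ _))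

  ΣΣ : (Split → Split → Carrier) → List Hyperedge → List Hyperedge → Carrier
  ΣΣ F xs ys = sumR (map (λ s → sumR (map (F s) (splits ys))) (splits xs))

  sumR-splits-++ : ∀ (f : Split → Carrier) xs ys →
                   sumR (map f (splits (xs ++ ys))) ≈ ΣΣ (λ s t → f (merge s t)) xs ys
  sumR-splits-++ f []       ys = ≈-sym (+-identityʳ _)
  sumR-splits-++ f (x ∷ xs) ys = begin
    sumR (map f (map withA (splits (xs ++ ys)) ++ map withN (splits (xs ++ ys))))
      ≈⟨ sumR-++ f (map withA (splits (xs ++ ys))) (map withN (splits (xs ++ ys))) ⟩
    sumR (map f (map withA (splits (xs ++ ys)))) + sumR (map f (map withN (splits (xs ++ ys))))
      ≡⟨ cong₂ _+_ (cong sumR (sym (Listₚ.map-∘ (splits (xs ++ ys)))))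
                   (cong sumR (sym (Listₚ.map-∘ (splits (xs ++ ys))))) ⟩
    sumR (map (f ∘ withA) (splits (xs ++ ys))) + sumR (map (f ∘ withN) (splits (xs ++ ys)))
      ≈⟨ +-cong (sumR-splits-++ (f ∘ withA) xs ys) (sumR-splits-++ (f ∘ withN) xs ys) ⟩
    ΣΣ (λ s t → f (withA (merge s t))) xs ys + ΣΣ (λ s t → f (withN (merge s t))) xs ys
      ≡⟨ cong₂ _+_ (cong sumR (Listₚ.map-∘ (splits xs))) (cong sumR (Listₚ.map-∘ (splits xs))) ⟩
    sumR (map G (map withA (splits xs))) + sumR (map G (map withN (splits xs)))
      ≈⟨ sumR-++ G (map withA (splits xs)) (map withN (splits xs)) ⟨
    ΣΣ (λ s t → f (merge s t)) (x ∷ xs) ys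
      ∎
    where
    withA withN : Split → Split
    withA (A , N) = x ∷ A , N
    withN (A , N) = A , x ∷ N
    G : Split → Carrier
    G s = sumR (map (λ t → f (merge s t)) (splits ys))

  ΣΣ-middle : ∀ (F : Split → Split → Carrier) xs e ys →
              ΣΣ F xs (e ∷ ys) ≈
              ΣΣ (λ s t → F s (e ∷ proj₁ t , proj₂ t) + F s (proj₁ t , e ∷ proj₂ t)) xs ys
  ΣΣ-middle F xs e ys = sumR-cong (splits xs) λ {s} _ → begin
    sumR (map (F s) (map withA (splits ys) ++ map withN (splits ys)))
      ≈⟨ sumR-++ (F s) (map withA (splits ys)) (map withN (splits ys)) ⟩
    sumR (map (F s) (map withA (splits ys))) + sumR (map (F s) (map withN (splits ys)))
      ≡⟨ cong₂ _+_ (cong sumR (sym (Listₚ.map-∘ (splits ys)))) (cong sumR (sym (Listₚ.map-∘ (splits ys)))) ⟩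
    sumR (map (F s ∘ withA) (splits ys)) + sumR (map (F s ∘ withN) (splits ys))
      ≈⟨ sumR-+ (F s ∘ withA) (F s ∘ withN) (splits ys) ⟨
    sumR (map (λ t → F s (withA t) + F s (withN t)) (splits ys))
      ∎
    where
    withA withN : Split → Split
    withA (A , N) = e ∷ A , N
    withN (A , N) = A , e ∷ N

  ΣΣ-cong : ∀ {F F′ : Split → Split → Carrier} xs ys →
            (∀ {s t} → s ∈ splits xs → t ∈ splits ys → F s t ≈ F′ s t) → ΣΣ F xs ys ≈ ΣΣ F′ xs ys
  ΣΣ-cong xs ys F≈F′ = sumR-cong (splits xs) λ s∈ → sumR-cong (splits ys) λ t∈ → F≈F′ s∈ t∈

  ΣΣ-linear : ∀ (a a′ : Carrier) (F F′ : Split → Split → Carrier) xs ys →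
              ΣΣ (λ s t → a * F s t + a′ * F′ s t) xs ys ≈ a * ΣΣ F xs ys + a′ * ΣΣ F′ xs ys
  ΣΣ-linear a a′ F F′ xs ys = begin
    sumR (map (λ s → sumR (map (λ t → a * F s t + a′ * F′ s t) (splits ys))) (splits xs))
      ≈⟨ sumR-cong (splits xs) (λ {s} _ → ≈-trans (sumR-+ _ _ (splits ys))
                                                  (+-cong (sumR-* a (F s) (splits ys)) (sumR-* a′ (F′ s) (splits ys)))) ⟩
    sumR (map (λ s → a * inner F s + a′ * inner F′ s) (splits xs))
      ≈⟨ sumR-+ _ _ (splits xs) ⟩
    sumR (map (λ s → a * inner F s) (splits xs)) + sumR (map (λ s → a′ * inner F′ s) (splits xs))
      ≈⟨ +-cong (sumR-* a _ (splits xs)) (sumR-* a′ _ (splits xs)) ⟩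
    a * ΣΣ F xs ys + a′ * ΣΣ F′ xs ys
      ∎
    where
    inner : (Split → Split → Carrier) → Split → Carrier
    inner F s = sumR (map (F s) (splits ys))

module IntegerPowers {c ℓ} (R : CommutativeRing c ℓ) where
  open CommutativeRing R renaming (refl to ≈-refl; sym to ≈-sym; trans to ≈-trans; reflexive to ≈-reflexive)
  open TuttePoly R
  open import Algebra.Properties.CommutativeSemigroup *-commutativeSemigroup using (interchange)

  pow-+ : ∀ a m n → pow a (m ℕ.+ n) ≈ pow a m * pow a n
  pow-+ a zero    n = ≈-sym (*-identityˡ _)
  pow-+ a (suc m) n = ≈-trans (*-cong ≈-refl (pow-+ a m n)) (≈-sym (*-assoc _ _ _))

  module _ {a a⁻ : Carrier} (aa⁻ : a * a⁻ ≈ 1#) where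

    powℤ-⊖ : ∀ m n → powℤ a a⁻ (m ℤ.⊖ n) ≈ pow a m * pow a⁻ n
    powℤ-⊖ m       zero    rewrite ℤₚ.⊖-≥ {m} {0} z≤n = ≈-sym (*-identityʳ _)
    powℤ-⊖ zero    (suc n) rewrite ℤₚ.⊖-< {0} {suc n} (s≤s z≤n) = ≈-sym (*-identityˡ _)
    powℤ-⊖ (suc m) (suc n) rewrite ℤₚ.[1+m]⊖[1+n]≡m⊖n m n = begin
      powℤ a a⁻ (m ℤ.⊖ n)                ≈⟨ powℤ-⊖ m n ⟩
      pow a m * pow a⁻ n                 ≈⟨ *-identityˡ _ ⟨
      1# * (pow a m * pow a⁻ n)          ≈⟨ *-cong aa⁻ ≈-refl ⟨
      (a * a⁻) * (pow a m * pow a⁻ n)    ≈⟨ interchange a a⁻ (pow a m) (pow a⁻ n) ⟩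
      pow a (suc m) * pow a⁻ (suc n)     ∎
      where open import Relation.Binary.Reasoning.Setoid setoid

    powℤ-+ : ∀ i j → powℤ a a⁻ (i +ℤ j) ≈ powℤ a a⁻ i * powℤ a a⁻ j
    powℤ-+ (+ m)    (+ n)    = pow-+ a m n
    powℤ-+ (+ m)    -[1+ n ] = powℤ-⊖ m (suc n)
    powℤ-+ -[1+ m ] (+ n)    = ≈-trans (powℤ-⊖ n (suc m)) (*-comm _ _)
    powℤ-+ -[1+ m ] -[1+ n ] =
      ≈-trans (≈-reflexive (cong (λ k → pow a⁻ (suc k)) (sym (ℕₚ.+-suc m n)))) (pow-+ a⁻ (suc m) (suc n))


-- The deletion–contraction recurrence

[δ+P]-[δ+Q]≡P-Q : ∀ δ P Q → (δ +ℤ P) -ℤ (δ +ℤ Q) ≡ P -ℤ Q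
[δ+P]-[δ+Q]≡P-Q = solve 3 (λ δ P Q → (δ :+ P) :- (δ :+ Q) := P :- Q) refl
  where open +-*-Solver

-- The w-exponent of a term whose A contains e, once 2ρ of its restriction is split as in ρ2-/ₕ.
contraction-exponent : ∀ de d n v v′ Q →
  (+ (2 ℕ.* (de ℕ.+ d)) -ℤ + (2 ℕ.* suc n)) -ℤ ((((+ v -ℤ + v′) +ℤ + de) -ℤ + 1) +ℤ Q) ≡
  (((+ v′ -ℤ + v) +ℤ + de) -ℤ + 1) +ℤ ((+ (2 ℕ.* d) -ℤ + (2 ℕ.* n)) -ℤ Q)
contraction-exponent de d n v v′ Q = begin
  (+ (2 ℕ.* (de ℕ.+ d)) -ℤ + (2 ℕ.* suc n)) -ℤ (δ +ℤ Q)
    ≡⟨ cong (λ t → t -ℤ (δ +ℤ Q)) (cong₂ _-ℤ_ (2*-+ de d) (2*-+ 1 n)) ⟩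
  (+ 2 ℤ.* (+ de +ℤ + d) -ℤ + 2 ℤ.* (+ 1 +ℤ + n)) -ℤ (δ +ℤ Q)
    ≡⟨ solve 6 (λ de d n v v′ Q →
                  (con (+ 2) :* (de :+ d) :- con (+ 2) :* (con (+ 1) :+ n)) :- ((((v :- v′) :+ de) :- con (+ 1)) :+ Q)
               := (((v′ :- v) :+ de) :- con (+ 1)) :+ ((con (+ 2) :* d :- con (+ 2) :* n) :- Q))
               refl (+ de) (+ d) (+ n) (+ v) (+ v′) Q ⟩
  δ′ +ℤ ((+ 2 ℤ.* + d -ℤ + 2 ℤ.* + n) -ℤ Q)
    ≡⟨ cong (λ t → δ′ +ℤ (t -ℤ Q)) (cong₂ _-ℤ_ (ℤₚ.pos-* 2 d) (ℤₚ.pos-* 2 n)) ⟨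
  δ′ +ℤ ((+ (2 ℕ.* d) -ℤ + (2 ℕ.* n)) -ℤ Q)
    ∎
  where
  open +-*-Solver
  open ≡.≡-Reasoning
  δ = ((+ v -ℤ + v′) +ℤ + de) -ℤ + 1
  δ′ = ((+ v′ -ℤ + v) +ℤ + de) -ℤ + 1
  2*-+ : ∀ a b → + (2 ℕ.* (a ℕ.+ b)) ≡ + 2 ℤ.* (+ a +ℤ + b)
  2*-+ a b = trans (ℤₚ.pos-* 2 (a ℕ.+ b)) (cong (+ 2 ℤ.*_) (ℤₚ.pos-+ a b))

module Recurrence {c ℓ} (R : CommutativeRing c ℓ) where
  open CommutativeRing R renaming (refl to ≈-refl; sym to ≈-sym; trans to ≈-trans; reflexive to ≈-reflexive)
  open TuttePoly R
  open SplitSums R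
  open IntegerPowers R
  open import Relation.Binary.Reasoning.Setoid setoid
  open import Algebra.Properties.CommutativeSemigroup *-commutativeSemigroup using (x∙yz≈y∙xz)

  module _ (u u⁻ w w⁻ : Carrier) (uu⁻ : u * u⁻ ≈ 1#) (ww⁻ : w * w⁻ ≈ 1#) where

    term : RawGehm → Split → Carrier
    term H (A , N) = powℤ u u⁻ (ρ2 H -ℤ ρ2 (restrict H N)) *
                     powℤ w w⁻ (((+ (2 ℕ.* dSet A)) -ℤ + (2 ℕ.* length A)) -ℤ ρ2 (restrict H N))

    T-no-hyperedges : ∀ {H} → IsPregehm H → hyperedges H ≡ [] → T u u⁻ w w⁻ H ≈ 1#
    T-no-hyperedges {H} pg E≡[] = begin
      sumR (map (term H) (splits (hyperedges H)))
        ≡⟨ cong (λ E → sumR (map (term H) (splits E))) E≡[] ⟩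
      term H ([] , []) + 0#
        ≈⟨ +-identityʳ _ ⟩
      powℤ u u⁻ (ρ -ℤ ρ) * powℤ w w⁻ ((+ 0 -ℤ + 0) -ℤ ρ)
        ≡⟨ cong (λ ρ′ → powℤ u u⁻ (ρ′ -ℤ ρ′) * powℤ w w⁻ ((+ 0 -ℤ + 0) -ℤ ρ′))
                (ρ2-no-hyperedges pg E≡[]) ⟩
      1# * 1#
        ≈⟨ *-identityˡ _ ⟩
      1#
        ∎
      where ρ = ρ2 H

    module _ {H : RawGehm} (pg : IsPregehm H) {e : Hyperedge} (e∈ : e ∈ hyperedges H) where

      αD αC : ℤ
      αD = ((+ fH (H ∖ₕ e) -ℤ + fH H) +ℤ + dEdge e) -ℤ + 1
      αC = ((+ vH (H /ₕ e) -ℤ + vH H) +ℤ + dEdge e) -ℤ + 1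

      term-∖ₕ : ∀ A N₁ N₂ → Deletable H (N₁ ++ e ∷ N₂) →
                term H (A , N₁ ++ e ∷ N₂) ≈ powℤ u u⁻ αD * term (H ∖ₕ e) (A , N₁ ++ N₂)
      term-∖ₕ A N₁ N₂ del = begin
        powℤ u u⁻ (ρ2 H -ℤ ρ2 Hᴺ) * powℤ w w⁻ (X -ℤ ρ2 Hᴺ)
          ≡⟨ cong₂ (λ i j → powℤ u u⁻ i * powℤ w w⁻ j) u-exp (cong (X -ℤ_) ρᴺ) ⟩
        powℤ u u⁻ (αD +ℤ (ρ2 (H ∖ₕ e) -ℤ Q)) * powℤ w w⁻ (X -ℤ Q)
          ≈⟨ *-cong (powℤ-+ uu⁻ αD _) ≈-refl ⟩
        (powℤ u u⁻ αD * powℤ u u⁻ (ρ2 (H ∖ₕ e) -ℤ Q)) * powℤ w w⁻ (X -ℤ Q)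
          ≈⟨ *-assoc _ _ _ ⟩
        powℤ u u⁻ αD * term (H ∖ₕ e) (A , N₁ ++ N₂)
          ∎
        where
        Hᴺ = restrict H (N₁ ++ e ∷ N₂)
        X = + (2 ℕ.* dSet A) -ℤ + (2 ℕ.* length A)
        Q = ρ2 (restrict (H ∖ₕ e) (N₁ ++ N₂))
        ρᴺ : ρ2 Hᴺ ≡ Q
        ρᴺ = ρ2-≅ (restrict-isPregehm pg del) (restrict-∖ₕ pg N₁ e N₂ del)
        u-exp : ρ2 H -ℤ ρ2 Hᴺ ≡ αD +ℤ (ρ2 (H ∖ₕ e) -ℤ Q)
        u-exp = trans (cong₂ _-ℤ_ (ρ2-∖ₕ pg e∈) ρᴺ) (ℤₚ.+-assoc αD (ρ2 (H ∖ₕ e)) (ℤ.- Q))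

      term-/ₕ : ∀ A₁ A₂ N → Deletable H (e ∷ N) →
                term H (A₁ ++ e ∷ A₂ , N) ≈ powℤ w w⁻ αC * term (H /ₕ e) (A₁ ++ A₂ , N)
      term-/ₕ A₁ A₂ N del@(e∉N ∷ uN , _ ∷ N∈) = begin
        powℤ u u⁻ (ρ2 H -ℤ ρ2 Hᴺ) * powℤ w w⁻ (X′ -ℤ ρ2 Hᴺ)
          ≡⟨ cong₂ (λ i j → powℤ u u⁻ i * powℤ w w⁻ j) u-exp w-exp ⟩
        powℤ u u⁻ (ρ2 (H /ₕ e) -ℤ Q) * powℤ w w⁻ (αC +ℤ (X -ℤ Q))
          ≈⟨ *-cong ≈-refl (powℤ-+ ww⁻ αC _) ⟩
        powℤ u u⁻ (ρ2 (H /ₕ e) -ℤ Q) * (powℤ w w⁻ αC * powℤ w w⁻ (X -ℤ Q))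
          ≈⟨ x∙yz≈y∙xz _ _ _ ⟩
        powℤ w w⁻ αC * term (H /ₕ e) (A₁ ++ A₂ , N)
          ∎
        where
        Hᴺ = restrict H N
        X′ = + (2 ℕ.* dSet (A₁ ++ e ∷ A₂)) -ℤ + (2 ℕ.* length (A₁ ++ e ∷ A₂))
        X = + (2 ℕ.* dSet (A₁ ++ A₂)) -ℤ + (2 ℕ.* length (A₁ ++ A₂))
        Q = ρ2 (restrict (H /ₕ e) N)
        δ = ((+ vH H -ℤ + vH (H /ₕ e)) +ℤ + dEdge e) -ℤ + 1
        pgᴺ = restrict-isPregehm pg (uN , N∈)
        e∈ᴺ = ∈-hyperedges-restrict pg (uN , N∈) e∈ (λ m → All.lookup e∉N m refl)
        pg/ᴺ = spliceᶜ-isPregehm pgᴺ blue e∈ᴺ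
        /-restrict = restrict-spliceᶜ blue pg del
        del/ : Deletable (H /ₕ e) N
        del/ = uN , All.tabulate λ m →
          ∈-hyperedges-splice H pg (b H) e∈ (All.lookup N∈ m) (λ n≡e → All.lookup e∉N m (sym n≡e))
        ρᴺ : ρ2 Hᴺ ≡ δ +ℤ Q
        ρᴺ = trans (ρ2-/ₕ pgᴺ e∈ᴺ)
                   (cong₂ _+ℤ_ (cong₂ (λ v v′ → ((+ v -ℤ + v′) +ℤ + dEdge e) -ℤ + 1)
                                      (vH-restrict pg (uN , N∈))
                                      (trans (vH-≅ pg/ᴺ /-restrict) (vH-restrict (spliceᶜ-isPregehm pg blue e∈) del/)))
                               (ρ2-≅ pg/ᴺ /-restrict))
        u-exp : ρ2 H -ℤ ρ2 Hᴺ ≡ ρ2 (H /ₕ e) -ℤ Q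
        u-exp = trans (cong₂ _-ℤ_ (ρ2-/ₕ pg e∈) ρᴺ) ([δ+P]-[δ+Q]≡P-Q δ (ρ2 (H /ₕ e)) Q)
        shift-e : A₁ ++ e ∷ A₂ ↭ e ∷ A₁ ++ A₂
        shift-e = ↭ₚ.shift e A₁ A₂
        w-exp : X′ -ℤ ρ2 Hᴺ ≡ αC +ℤ (X -ℤ Q)
        w-exp = trans (cong₂ (λ d n → (+ (2 ℕ.* d) -ℤ + (2 ℕ.* n)) -ℤ ρ2 Hᴺ)
                             (sum-↭ (↭ₚ.map⁺ dEdge shift-e)) (↭ₚ.↭-length shift-e))
                (trans (cong ((+ (2 ℕ.* (dEdge e ℕ.+ d)) -ℤ + (2 ℕ.* suc n)) -ℤ_) ρᴺ)
                       (contraction-exponent (dEdge e) d n (vH H) (vH (H /ₕ e)) Q))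
          where
          d = dSet (A₁ ++ A₂)
          n = length (A₁ ++ A₂)

      T-recurrence : T u u⁻ w w⁻ H ≈
                     powℤ u u⁻ αD * T u u⁻ w w⁻ (H ∖ₕ e) + powℤ w w⁻ αC * T u u⁻ w w⁻ (H /ₕ e)
      T-recurrence = begin
        sumR (map (term H) (splits (hyperedges H)))
          ≡⟨ cong (λ E → sumR (map (term H) (splits E))) E≡ ⟩
        sumR (map (term H) (splits (pre ++ e ∷ post)))
          ≈⟨ sumR-splits-++ (term H) pre (e ∷ post) ⟩
        ΣΣ (λ s t → term H (merge s t)) pre (e ∷ post)
          ≈⟨ ΣΣ-middle (λ s t → term H (merge s t)) pre e post ⟩
        ΣΣ (λ s t → term H (merge s (e ∷ proj₁ t , proj₂ t)) + term H (merge s (proj₁ t , e ∷ proj₂ t)))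
           pre post
          ≈⟨ ΣΣ-cong pre post split-terms ⟩
        ΣΣ (λ s t → powℤ w w⁻ αC * term (H /ₕ e) (merge s t) + powℤ u u⁻ αD * term (H ∖ₕ e) (merge s t))
           pre post
          ≈⟨ ΣΣ-linear (powℤ w w⁻ αC) (powℤ u u⁻ αD) _ _ pre post ⟩
        powℤ w w⁻ αC * ΣΣ (λ s t → term (H /ₕ e) (merge s t)) pre post +
        powℤ u u⁻ αD * ΣΣ (λ s t → term (H ∖ₕ e) (merge s t)) pre post
          ≈⟨ +-cong (*-cong ≈-refl (T-split blue)) (*-cong ≈-refl (T-split red)) ⟨
        powℤ w w⁻ αC * T u u⁻ w w⁻ (H /ₕ e) + powℤ u u⁻ αD * T u u⁻ w w⁻ (H ∖ₕ e)
          ≈⟨ +-comm _ _ ⟩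
        powℤ u u⁻ αD * T u u⁻ w w⁻ (H ∖ₕ e) + powℤ w w⁻ αC * T u u⁻ w w⁻ (H /ₕ e)
          ∎
        where
        split : ∃ λ pre → ∃ λ post → hyperedges H ≡ pre ++ e ∷ post
        split = ∈ₚ.∈-∃++ e∈
        pre = proj₁ split
        post = proj₁ (proj₂ split)
        E≡ = proj₂ (proj₂ split)
        T-split : ∀ κ → T u u⁻ w w⁻ (spliceᶜ κ H e) ≈ ΣΣ (λ s t → term (spliceᶜ κ H e) (merge s t)) pre post
        T-split κ = ≈-trans (≈-reflexive (cong (λ E → sumR (map (term (spliceᶜ κ H e)) (splits E))) E′≡))
                            (sumR-splits-++ (term (spliceᶜ κ H e)) pre post)
          where
          E′≡ : hyperedges (spliceᶜ κ H e) ≡ pre ++ post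
          E′≡ = trans (Hyperedges.Edge.hyperedges-splice H pg e∈ (colour κ H))
                      (trans (cong (removeE e) E≡)
                             (removeE-middle pre post e (subst Unique E≡ (Hyperedges.hyperedges-unique H pg))))
        split-terms : ∀ {s t} → s ∈ splits pre → t ∈ splits post →
                      term H (merge s (e ∷ proj₁ t , proj₂ t)) + term H (merge s (proj₁ t , e ∷ proj₂ t)) ≈
                      powℤ w w⁻ αC * term (H /ₕ e) (merge s t) + powℤ u u⁻ αD * term (H ∖ₕ e) (merge s t)
        split-terms {A₁ , N₁} {A₂ , N₂} s∈ t∈ =
          +-cong (term-/ₕ A₁ A₂ (N₁ ++ N₂) (Deletable-↭ {H} (↭ₚ.shift e N₁ N₂) del))
                 (term-∖ₕ (A₁ ++ A₂) N₁ N₂ del)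
          where
          del : Deletable H (N₁ ++ e ∷ N₂)
          del = Deletable-⊆ pg (subst (N₁ ++ e ∷ N₂ ⊆_) (sym E≡)
                                 (Sublistₚ.++⁺ (proj₂ (splits-⊆ pre s∈)) (refl ∷ proj₂ (splits-⊆ post t∈))))

theorem1 : ∀ {c ℓ : Level} (R : CommutativeRing c ℓ) →
    let open CommutativeRing R in
    let open TuttePoly R in
    (u u⁻ w w⁻ : Carrier) → u * u⁻ ≈ 1# → w * w⁻ ≈ 1# →
    (H : RawGehm) → IsGehm H →
      (hyperedges H ≡ [] → T u u⁻ w w⁻ H ≈ 1#) ×
      (∀ e → e ∈ hyperedges H →
        T u u⁻ w w⁻ H ≈
          powℤ u u⁻ (((+ fH (H ∖ₕ e) -ℤ + fH H) +ℤ + dEdge e) -ℤ + 1) * T u u⁻ w w⁻ (H ∖ₕ e)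
          + powℤ w w⁻ (((+ vH (H /ₕ e) -ℤ + vH H) +ℤ + dEdge e) -ℤ + 1) * T u u⁻ w w⁻ (H /ₕ e))
theorem1 R u u⁻ w w⁻ uu⁻ ww⁻ H isGehm =
  T-no-hyperedges u u⁻ w w⁻ uu⁻ ww⁻ pg , λ e e∈ → T-recurrence u u⁻ w w⁻ uu⁻ ww⁻ pg e∈
  where
  open Recurrence R
  pg = IsGehm⇒IsPregehm isGehm
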